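{- Let $Z=(U,\Omega,r)$ be a non-degenerate multimatroid and let $\prec$ be a total ordering of its skew classes. Then \[ Q(Z;\mathbf x,t)= \sum_{B\in \mathcal B(Z)} \Bigg(\prod_{\omega \in \mathrm{inact}_{\prec}(B)} \mathbf x_{B_{\omega}}\Bigg) \Bigg(\prod_{\omega \in \mathrm{act}_{\prec}(B)} \Big(\frac {t\,\mathbf x_{\underline B_{\omega}}} {|\omega|-1}+\mathbf x_{B_{\omega}}\Big)\Bigg),\] where $\mathcal B(Z)$ is the set of bases of $Z$.
   Context: A carrier is a pair $(U,\Omega)$ with $U$ a finite set and $\Omega$ a partition of $U$ into non-empty blocks called skew classes. A skew pair is a pair of distinct elements of the same skew class. A subtransversal is a subset of $U$ meeting each skew class at most once; a transversal meets every skew class exactly once. A multimatroid $Z=(U,\Omega,r)$ consists of a carrier and a non-negative integer function $r$ on subtransversals such that (R1) for every transversal $T$, $T$ with $r$ restricted to subsets of $T$ is a matroid (given by its rank function); (R2) for every subtransversal $S$ and skew pair $\{x,y\}$ from a skew class disjoint from $S$, $r(S\cup\{x\})+r(S\cup\{y\})-2r(S)\ge 1$. The nullity is $n(S)=|S|-r(S)$; $S$ is independent if $n(S)=0$, a basis is a maximal independent subtransversal, a circuit is a minimal dependent subtransversal. $Z$ is non-degenerate if every skew class has at least two elements; then bases are transversals. For a subtransversal $S$ meeting $\omega$, $S_\omega$ is the unique element of $S\cap\omega$. For a basis $B$ and skew class $\omega$, $B\cup\omega$ contains at most one circuit; if it exists it is called the fundamental circuit $C(B,\omega)$, and $\underline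 B_\omega$ denotes the unique element of $C(B,\omega)-B$. A total ordering $\prec$ of the skew classes induces a total ordering of the elements of any subtransversal $S$; $\min(S)$ is its least element. A skew class $\omega$ is active with respect to a basis $B$ if $C(B,\omega)$ exists and $\min(C(B,\omega))\in\omega$; otherwise it is inactive. $\mathrm{act}_\prec(B)$ and $\mathrm{inact}_\prec(B)$ are the sets of active and inactive skew classes. The weighted transition polynomial is $Q(Z;\mathbf x,t)=\sum_{T} t^{n(T)}\mathbf x_T$, the sum over all transversals $T$, where $\mathbf x=(\mathbf x_u)_{u\in U}$ are indeterminates and $\mathbf x_T=\prod_{u\in T}\mathbf x_u$. -}

module Defs where

open import Level using (0ℓ)
open import Data.Nat as ℕ using (ℕ; zero; suc; _≤_; _∸_)
open import Data.Integer using (+_)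
open import Data.Rational using (ℚ; 0ℚ; 1ℚ; _+_; _*_; _/_)
open import Data.Bool using (true; false)
open import Data.Fin using (Fin)
open import Data.Fin.Properties using (any?; all?) renaming (_≟_ to _≟ᶠ_)
open import Data.Fin.Subset using (Subset; inside; outside; _∈_; _∉_; _⊆_; _∪_; _∩_; ⁅_⁆; ∣_∣)
open import Data.Fin.Subset.Properties using (anySubset?; _∈?_; _⊆?_)
open import Data.Vec using (Vec; []; _∷_)
open import Data.Vec.Properties using (≡-dec)
open import Data.Bool.Properties using () renaming (_≟_ to _≟ᵇ_)
open import Data.Product using (Σ; ∃; ∃₂; _×_; _,_)
open import Data.Sum using (_⊎_)
open import Relation.Nullary using (¬_; Dec; yes; no; ¬?; _×-dec_; _→-dec_; _⊎-dec_)
open import Relation.Nullary.Decidable using (map′; decidable-stable)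
open import Relation.Binary using (Rel; IsStrictTotalOrder)
open import Relation.Binary.PropositionalEquality using (_≡_; _≢_)

sumFin : ∀ {k} → (Fin k → ℚ) → ℚ
sumFin {zero}  f = 0ℚ
sumFin {suc k} f = f Fin.zero + sumFin (λ i → f (Fin.suc i))

prodFin : ∀ {k} → (Fin k → ℚ) → ℚ
prodFin {zero}  f = 1ℚ
prodFin {suc k} f = f Fin.zero * prodFin (λ i → f (Fin.suc i))

countFin : ∀ {k} → (Fin k → ℕ) → ℕ
countFin {zero}  f = 0
countFin {suc k} f = f Fin.zero ℕ.+ countFin (λ i → f (Fin.suc i))

sumSub : ∀ {k} → (Subset k → ℚ) → ℚ
sumSub {zero}  f = f []
sumSub {suc k} f = sumSub (λ s → f (inside ∷ s)) + sumSub (λ s → f (outside ∷ s))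

sumSubWhere : ∀ {k} {P : Subset k → Set} → (∀ s → Dec (P s)) → (Subset k → ℚ) → ℚ
sumSubWhere P? f = sumSub (λ s → if? (P? s) (f s))
  where
  if? : ∀ {A : Set} → Dec A → ℚ → ℚ
  if? (yes _) q = q
  if? (no _)  q = 0ℚ

prodIn : ∀ {k} → Subset k → (Fin k → ℚ) → ℚ
prodIn S f = prodFin (λ u → g (u ∈? S) u)
  where
  g : ∀ {u} → Dec (u ∈ S) → Fin _ → ℚ
  g (yes _) u = f u
  g (no _)  u = 1ℚ

_^ℚ_ : ℚ → ℕ → ℚ
q ^ℚ zero  = 1ℚ
q ^ℚ suc k = q * (q ^ℚ k)

-- 1/k for k ≥ 1 (the value at k = 0 is an irrelevant convention)
inv : ℕ → ℚ
inv zero    = 0ℚ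
inv (suc k) = (+ 1) / suc k

allSub? : ∀ {k} {P : Subset k → Set} → (∀ s → Dec (P s)) → Dec (∀ s → P s)
allSub? P? with anySubset? (λ s → ¬? (P? s))
... | yes (s , ¬p) = no (λ all → ¬p (all s))
... | no ¬ex = yes (λ s → decidable-stable (P? s) (λ ¬p → ¬ex (s , ¬p)))

-- Carriers: U = Fin n, skew classes indexed by Fin m, cls u = class of u

module _ {n m : ℕ} (cls : Fin n → Fin m) where

  Subtransversal : Subset n → Set
  Subtransversal S = ∀ x y → x ∈ S → y ∈ S → cls x ≡ cls y → x ≡ y

  Transversal : Subset n → Set
  Transversal T = Subtransversal T × (∀ ω → ∃ λ u → u ∈ T × cls u ≡ ω)

  subtransversal? : ∀ S → Dec (Subtransversal S)
  subtransversal? S = all? λ x → all? λ y →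
    (x ∈? S) →-dec (y ∈? S) →-dec (cls x ≟ᶠ cls y) →-dec (x ≟ᶠ y)

  transversal? : ∀ T → Dec (Transversal T)
  transversal? T = subtransversal? T ×-dec
    all? (λ ω → any? (λ u → (u ∈? T) ×-dec (cls u ≟ᶠ ω)))

  classSize : Fin m → ℕ
  classSize ω = countFin (λ u → ind (cls u ≟ᶠ ω))
    where
    ind : ∀ {A : Set} → Dec A → ℕ
    ind (yes _) = 1
    ind (no _)  = 0

record IsMatroidRankOn {n : ℕ} (r : Subset n → ℕ) (T : Subset n) : Set where
  field
    bounded    : ∀ X → X ⊆ T → r X ≤ ∣ X ∣
    monotone   : ∀ X Y → X ⊆ T → Y ⊆ T → X ⊆ Y → r X ≤ r Y
    submodular : ∀ X Y → X ⊆ T → Y ⊆ T →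
                 r (X ∪ Y) ℕ.+ r (X ∩ Y) ≤ r X ℕ.+ r Y

-- A multimatroid on U = Fin n with skew classes indexed by Fin m.
-- r is given on all subsets, but only its values on subtransversals matter.
record Multimatroid (n m : ℕ) : Set where
  field
    cls      : Fin n → Fin m
    nonempty : ∀ ω → ∃ λ u → cls u ≡ ω
    r        : Subset n → ℕ
    R1       : ∀ T → Transversal cls T → IsMatroidRankOn r T
    R2       : ∀ S x y → Subtransversal cls S → x ≢ y → cls x ≡ cls y →
               (∀ z → z ∈ S → cls z ≢ cls x) →
               ℕ.suc (2 ℕ.* r S) ≤ r (S ∪ ⁅ x ⁆) ℕ.+ r (S ∪ ⁅ y ⁆)

module _ {n m : ℕ} (Z : Multimatroid n m) where
  open Multimatroid Z

  NonDegenerate : Set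
  NonDegenerate = ∀ ω → ∃₂ λ x y → x ≢ y × cls x ≡ ω × cls y ≡ ω

  nullity : Subset n → ℕ
  nullity S = ∣ S ∣ ∸ r S

  Independent : Subset n → Set
  Independent S = Subtransversal cls S × r S ≡ ∣ S ∣

  independent? : ∀ S → Dec (Independent S)
  independent? S = subtransversal? cls S ×-dec (r S ℕ.≟ ∣ S ∣)

  Basis : Subset n → Set
  Basis B = Independent B × (∀ S → Independent S → B ⊆ S → S ≡ B)

  basis? : ∀ B → Dec (Basis B)
  basis? B = independent? B ×-dec allSub? (λ S →
    independent? S →-dec (B ⊆? S) →-dec ≡-dec _≟ᵇ_ S B)

  Circuit : Subset n → Set
  Circuit C = Subtransversal cls C × r C ≢ ∣ C ∣ ×
              (∀ D → D ⊆ C → D ≢ C → r D ≡ ∣ D ∣)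

  circuit? : ∀ C → Dec (Circuit C)
  circuit? C = subtransversal? cls C ×-dec ¬? (r C ℕ.≟ ∣ C ∣) ×-dec
    allSub? (λ D → (D ⊆? C) →-dec ¬? (≡-dec _≟ᵇ_ D C) →-dec (r D ℕ.≟ ∣ D ∣))

  InBω : Subset n → Fin m → Subset n → Set
  InBω B ω C = ∀ u → u ∈ C → u ∈ B ⊎ cls u ≡ ω

  inBω? : ∀ B ω C → Dec (InBω B ω C)
  inBω? B ω C = all? λ u → (u ∈? C) →-dec ((u ∈? B) ⊎-dec (cls u ≟ᶠ ω))

  -- search for the (unique, if existing) circuit contained in B ∪ ω,
  -- i.e. the fundamental circuit C(B, ω)
  fundCirc? : ∀ B ω → Dec (∃ λ C → Circuit C × InBω B ω C)
  fundCirc? B ω = anySubset? (λ C → circuit? C ×-dec inBω? B ω C)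

  module _ (x : Fin n → ℚ) (t : ℚ) where

    Q : ℚ
    Q = sumSubWhere (transversal? cls) (λ T → (t ^ℚ nullity T) * prodIn T x)

    xOfIn : Subset n → Fin m → ℚ
    xOfIn S ω with any? (λ u → (u ∈? S) ×-dec (cls u ≟ᶠ ω))
    ... | yes (u , _) = x u
    ... | no _        = 0ℚ

    xOfDiff : Subset n → Subset n → ℚ
    xOfDiff C B with any? (λ u → (u ∈? C) ×-dec ¬? (u ∈? B))
    ... | yes (u , _) = x u
    ... | no _        = 0ℚ

    module _ (_≺_ : Rel (Fin m) 0ℓ) (sto : IsStrictTotalOrder _≡_ _≺_) where
      open IsStrictTotalOrder sto using (_<?_)

      MinIn : Subset n → Fin m → Set
      MinIn C ω = (∃ λ u → u ∈ C × cls u ≡ ω) ×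
                  (∀ u → u ∈ C → cls u ≢ ω → ω ≺ cls u)

      minIn? : ∀ C ω → Dec (MinIn C ω)
      minIn? C ω = any? (λ u → (u ∈? C) ×-dec (cls u ≟ᶠ ω)) ×-dec
        all? (λ u → (u ∈? C) →-dec ¬? (cls u ≟ᶠ ω) →-dec (ω <? cls u))

      -- factor of skew class ω in the summand for basis B:
      -- active   ↦  t x_{B̲_ω} / (|ω| - 1) + x_{B_ω}
      -- inactive ↦  x_{B_ω}
      factor : Subset n → Fin m → ℚ
      factor B ω with fundCirc? B ω
      ... | no _ = xOfIn B ω
      ... | yes (C , _) with minIn? C ω
      ...   | yes _ = (t * xOfDiff C B) * inv (classSize cls ω ∸ 1) + xOfIn B ω
      ...   | no _  = xOfIn B ω

      RHS : ℚ
      RHS = sumSubWhere basis? (λ B → prodFin (factor B))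

{-# OPTIONS --safe #-}
module Submission where

-- Generalise from ∅ to subtransversals P whose met classes form an up-set for ≺: the sum of
-- t^n(T) x_T over the transversals T ⊇ P equals t^n(P) x_P times a sum, over the bases S of the
-- contraction Z / P, of products of activity factors. This is trivial when P is a transversal, and
-- it descends to P from the sets P ∪ {u}, u in the largest class ω₀ missed by P. If ω₀ has no loop
-- over P, every u adds rank and the identity carries over unchanged. If ω₀ has a loop v (unique by
-- R2), every other u adds rank, and r(X ∪ u) = r(X ∪ v) + 1 for all X ⊇ P makes the contraction
-- sums for P ∪ u and P ∪ v agree; the extra t x_v of the term for v, split evenly over the |ω₀| − 1
-- other elements, produces the active factor. On a basis B the two notions of activity agree: ω has
-- a loop over the elements of B above ω exactly when the fundamental circuit C(B, ω) has its minimum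
-- in ω.

open import Defs
open import Level using (0ℓ)
open import Algebra.Bundles using (CommutativeMonoid)
import Algebra.Properties.CommutativeSemigroup as CommSemigroupProperties
open import Data.Bool using (if_then_else_)
open import Data.Empty using (⊥-elim)
open import Data.Fin using (Fin; zero; suc)
open import Data.Fin.Properties using (suc-injective; any?; all?) renaming (_≟_ to _≟ᶠ_)
open import Data.Fin.Subset using (Subset; _⊂_; _⊃_; inside; outside; _∈_; _∉_; _⊆_; _∪_; _─_; _-_; ⁅_⁆; ∣_∣; ⊥)
open import Data.Fin.Subset.Properties
  using (_∈?_; _⊆?_; anySubset?; ∪-identityˡ; ∪-identityʳ; ∪-assoc; ∪-comm; ⊆-antisym; p⊆p∪q; q⊆p∪q;
         x∈p∪q⁻; p─q⊆p; x∈p∧x≢y⇒x∈p-y; x∈⁅x⁆; x∈⁅y⁆⇒x≡y; ∣⁅x⁆∣≡1;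
         drop-there; x∈p∧x∉q⇒x∈p─q; ∉⊥; ∣⊥∣≡0; x∈p∩q⁻; x∈p∩q⁺)
import Data.Integer as ℤ
import Data.Integer.Properties as ℤ
open import Data.Nat as ℕ using (ℕ; zero; suc; _∸_)
import Data.Nat.Properties as ℕ
open import Data.Nat.Coprimality using (1-coprimeTo) renaming (sym to coprime-sym)
open import Data.Product as Product using (∃; _×_; _,_; proj₁; proj₂)
open import Data.Sum as Sum using (_⊎_; inj₁; inj₂; [_,_]′)
open import Function using (case_of_)
open import Data.Rational using (ℚ; 0ℚ; 1ℚ; _+_; _*_; _/_; 1/_; mkℚ)
import Data.Rational.Properties as ℚ
open import Data.Rational.Solver using (module +-*-Solver)
open import Data.Vec using (_∷_; []; here; there)
open import Data.Vec.Properties using (≡-dec)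
open import Data.Bool.Properties using () renaming (_≟_ to _≟ᵇ_)
open import Data.Fin.Subset.Induction using (⊂-wellFounded; ⊃-wellFounded; Acc; acc)
open import Data.List using (List; filter; allFin)
import Data.List.Extrema as Extrema
open import Data.List.Membership.Propositional.Properties using (∈-filter⁺; ∈-allFin)
open import Data.List.Relation.Unary.All using (lookup)
open import Data.List.Relation.Unary.All.Properties using (all-filter)
open import Relation.Binary.Bundles using (TotalOrder)
import Relation.Binary.Construct.StrictToNonStrict as StrictToNonStrict
open import Relation.Binary using (Rel; IsStrictTotalOrder; tri<; tri≈; tri>)
open import Relation.Binary.PropositionalEquality
open import Relation.Nullary using (¬_; Dec; yes; no; does; ¬?; _×-dec_; _⊎-dec_; _→-dec_)
open import Relation.Nullary.Decidable using (dec-true; dec-false; decidable-stable)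

open +-*-Solver

private
  module ℚ+ = CommSemigroupProperties (CommutativeMonoid.commutativeSemigroup ℚ.+-0-commutativeMonoid)
  module ℚ* = CommSemigroupProperties (CommutativeMonoid.commutativeSemigroup ℚ.*-1-commutativeMonoid)
  module ℕ+ = CommSemigroupProperties ℕ.+-commutativeSemigroup

private
  variable
    A B : Set

when : Dec A → ℚ → ℚ
when d q = if does d then q else 0ℚ

when-yes : ∀ (d : Dec A) {q} → A → when d q ≡ q
when-yes d a rewrite dec-true d a = refl

when-no : ∀ (d : Dec A) {q} → ¬ A → when d q ≡ 0ℚ
when-no d ¬a rewrite dec-false d ¬a = refl

when-cong : ∀ (d : Dec A) {p q} → (A → p ≡ q) → when d p ≡ when d q
when-cong (yes a) p≡q = p≡q a
when-cong (no _)  _   = refl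

when-⇔ : ∀ (d : Dec A) (e : Dec B) {p q} → (A → B) → (B → A) → (A → p ≡ q) → when d p ≡ when e q
when-⇔ (yes a) e A→B B→A p≡q = trans (p≡q a) (sym (when-yes e (A→B a)))
when-⇔ (no ¬a) e A→B B→A p≡q = sym (when-no e (λ b → ¬a (B→A b)))

when-zero : ∀ (d : Dec A) → when d 0ℚ ≡ 0ℚ
when-zero (yes _) = refl
when-zero (no _)  = refl

when-*ˡ : ∀ (d : Dec A) c q → when d (c * q) ≡ c * when d q
when-*ˡ (yes _) c q = refl
when-*ˡ (no _)  c q = sym (ℚ.*-zeroʳ c)

when-when-disjoint : ∀ (d : Dec A) (e : Dec B) {q} → ¬ (A × B) → when d (when e q) ≡ 0ℚ
when-when-disjoint (yes a) e disj = when-no e (λ b → disj (a , b))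
when-when-disjoint (no _)  e disj = refl

when-when : ∀ (d : Dec A) (e : Dec B) {q} → when d (when e q) ≡ when (d ×-dec e) q
when-when (yes _) e = refl
when-when (no _)  e = refl

when-split : ∀ (d : Dec A) (e : Dec B) {q} → (B → A) →
             when d q ≡ when e q + when (d ×-dec ¬? e) q
when-split (yes _) (yes _) {q} _   = sym (ℚ.+-identityʳ q)
when-split (yes _) (no _)  {q} _   = sym (ℚ.+-identityˡ q)
when-split (no ¬a) (yes b)     B→A = ⊥-elim (¬a (B→A b))
when-split (no _)  (no _)      _   = sym (ℚ.+-identityˡ 0ℚ)

when-+ : ∀ (d : Dec A) p q → when d (p + q) ≡ when d p + when d q
when-+ (yes _) p q = refl
when-+ (no _)  p q = sym (ℚ.+-identityˡ 0ℚ)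

if-yes : ∀ (d : Dec A) {a b : ℚ} → A → (if does d then a else b) ≡ a
if-yes d a rewrite dec-true d a = refl

if-no : ∀ (d : Dec A) {a b : ℚ} → ¬ A → (if does d then a else b) ≡ b
if-no d ¬a rewrite dec-false d ¬a = refl

if-⇔ : ∀ (d : Dec A) (e : Dec B) {a b : ℚ} → (A → B) → (B → A) →
       (if does d then a else b) ≡ (if does e then a else b)
if-⇔ (yes a) e A→B _ = sym (if-yes e (A→B a))
if-⇔ (no ¬a) e _ B→A = sym (if-no e (λ b → ¬a (B→A b)))

sumFin-cong : ∀ {k} {f g : Fin k → ℚ} → (∀ i → f i ≡ g i) → sumFin f ≡ sumFin g
sumFin-cong {zero}  f≗g = refl
sumFin-cong {suc k} f≗g = cong₂ _+_ (f≗g zero) (sumFin-cong (λ i → f≗g (suc i)))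

sumFin-+ : ∀ {k} (f g : Fin k → ℚ) → sumFin (λ i → f i + g i) ≡ sumFin f + sumFin g
sumFin-+ {zero}  f g = sym (ℚ.+-identityˡ 0ℚ)
sumFin-+ {suc k} f g = trans (cong (f zero + g zero +_) (sumFin-+ (λ i → f (suc i)) (λ i → g (suc i))))
  (ℚ+.interchange (f zero) (g zero) _ _)

sumFin-*ˡ : ∀ {k} c (f : Fin k → ℚ) → sumFin (λ i → c * f i) ≡ c * sumFin f
sumFin-*ˡ {zero}  c f = sym (ℚ.*-zeroʳ c)
sumFin-*ˡ {suc k} c f = trans (cong (c * f zero +_) (sumFin-*ˡ c (λ i → f (suc i))))
  (sym (ℚ.*-distribˡ-+ c (f zero) _))

sumFin-zero : ∀ {k} {f : Fin k → ℚ} → (∀ i → f i ≡ 0ℚ) → sumFin f ≡ 0ℚ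
sumFin-zero {zero}  f≗0 = refl
sumFin-zero {suc k} f≗0 = trans (cong₂ _+_ (f≗0 zero) (sumFin-zero (λ i → f≗0 (suc i)))) (ℚ.+-identityˡ 0ℚ)

sumFin-single : ∀ {k} {f : Fin k → ℚ} j → (∀ i → i ≢ j → f i ≡ 0ℚ) → sumFin f ≡ f j
sumFin-single {suc k} {f} zero f≗0 =
  trans (cong (f zero +_) (sumFin-zero (λ i → f≗0 (suc i) λ ()))) (ℚ.+-identityʳ (f zero))
sumFin-single {suc k} {f} (suc j) f≗0 =
  trans (cong (_+ sumFin (λ i → f (suc i))) (f≗0 zero λ ()))
    (trans (ℚ.+-identityˡ _) (sumFin-single j (λ i i≢j → f≗0 (suc i) (λ eq → i≢j (suc-injective eq)))))

sumFin-when-*ˡ : ∀ {k} {P : Fin k → Set} (P? : ∀ i → Dec (P i)) c (f : Fin k → ℚ) →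
                 sumFin (λ i → when (P? i) (c * f i)) ≡ c * sumFin (λ i → when (P? i) (f i))
sumFin-when-*ˡ P? c f = trans (sumFin-cong (λ i → when-*ˡ (P? i) c (f i))) (sumFin-*ˡ c (λ i → when (P? i) (f i)))

sumFin-when-unique : ∀ {k} {P : Fin k → Set} (P? : ∀ i → Dec (P i)) {q} j → P j → (∀ {i} → P i → i ≡ j) →
                     sumFin (λ i → when (P? i) q) ≡ q
sumFin-when-unique P? j pj unique =
  trans (sumFin-single j (λ i i≢j → when-no (P? i) (λ pi → i≢j (unique pi)))) (when-yes (P? j) pj)

prodFin-cong : ∀ {k} {f g : Fin k → ℚ} → (∀ i → f i ≡ g i) → prodFin f ≡ prodFin g
prodFin-cong {zero}  f≗g = refl
prodFin-cong {suc k} f≗g = cong₂ _*_ (f≗g zero) (prodFin-cong (λ i → f≗g (suc i)))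

prodFin-one : ∀ {k} {f : Fin k → ℚ} → (∀ i → f i ≡ 1ℚ) → prodFin f ≡ 1ℚ
prodFin-one {zero}  f≗1 = refl
prodFin-one {suc k} f≗1 = trans (cong₂ _*_ (f≗1 zero) (prodFin-one (λ i → f≗1 (suc i)))) (ℚ.*-identityˡ 1ℚ)

prodFin-extract : ∀ {k} {f g : Fin k → ℚ} j → g j ≡ 1ℚ → (∀ i → i ≢ j → f i ≡ g i) →
                  prodFin f ≡ f j * prodFin g
prodFin-extract {suc k} {f} {g} zero gj≡1 f≗g =
  cong (f zero *_) (trans (prodFin-cong (λ i → f≗g (suc i) λ ()))
    (sym (trans (cong (_* prodFin (λ i → g (suc i))) gj≡1) (ℚ.*-identityˡ _))))
prodFin-extract {suc k} {f} {g} (suc j) gj≡1 f≗g =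
  trans (cong₂ _*_ (f≗g zero λ ()) (prodFin-extract j gj≡1 (λ i i≢j → f≗g (suc i) (λ eq → i≢j (suc-injective eq)))))
    (ℚ*.x∙yz≈y∙xz (g zero) (f (suc j)) _)

sumSub-cong : ∀ {k} {f g : Subset k → ℚ} → (∀ s → f s ≡ g s) → sumSub f ≡ sumSub g
sumSub-cong {zero}  f≗g = f≗g []
sumSub-cong {suc k} f≗g = cong₂ _+_ (sumSub-cong (λ s → f≗g (inside ∷ s))) (sumSub-cong (λ s → f≗g (outside ∷ s)))

sumSub-+ : ∀ {k} (f g : Subset k → ℚ) → sumSub (λ s → f s + g s) ≡ sumSub f + sumSub g
sumSub-+ {zero}  f g = refl
sumSub-+ {suc k} f g =
  trans (cong₂ _+_ (sumSub-+ (λ s → f (inside ∷ s)) (λ s → g (inside ∷ s)))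
                   (sumSub-+ (λ s → f (outside ∷ s)) (λ s → g (outside ∷ s))))
    (ℚ+.interchange (sumSub (λ s → f (inside ∷ s))) _ _ _)

sumSub-*ˡ : ∀ {k} c (f : Subset k → ℚ) → sumSub (λ s → c * f s) ≡ c * sumSub f
sumSub-*ˡ {zero}  c f = refl
sumSub-*ˡ {suc k} c f =
  trans (cong₂ _+_ (sumSub-*ˡ c (λ s → f (inside ∷ s))) (sumSub-*ˡ c (λ s → f (outside ∷ s))))
    (sym (ℚ.*-distribˡ-+ c _ _))

sumSub-zero : ∀ {k} {f : Subset k → ℚ} → (∀ s → f s ≡ 0ℚ) → sumSub f ≡ 0ℚ
sumSub-zero {zero}  f≗0 = f≗0 []
sumSub-zero {suc k} f≗0 =
  trans (cong₂ _+_ (sumSub-zero (λ s → f≗0 (inside ∷ s))) (sumSub-zero (λ s → f≗0 (outside ∷ s))))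
    (ℚ.+-identityˡ 0ℚ)

sumSub-single : ∀ {k} {f : Subset k → ℚ} p → (∀ s → s ≢ p → f s ≡ 0ℚ) → sumSub f ≡ f p
sumSub-single {zero} [] f≗0 = refl
sumSub-single {suc k} (inside ∷ p) f≗0 =
  trans (cong₂ _+_ (sumSub-single p (λ s s≢p → f≗0 (inside ∷ s) (λ { refl → s≢p refl })))
                   (sumSub-zero (λ s → f≗0 (outside ∷ s) λ ())))
    (ℚ.+-identityʳ _)
sumSub-single {suc k} (outside ∷ p) f≗0 =
  trans (cong₂ _+_ (sumSub-zero (λ s → f≗0 (inside ∷ s) λ ()))
                   (sumSub-single p (λ s s≢p → f≗0 (outside ∷ s) (λ { refl → s≢p refl }))))
    (ℚ.+-identityˡ _)

when-sumSub : ∀ {k} (d : Dec A) (f : Subset k → ℚ) → when d (sumSub f) ≡ sumSub (λ s → when d (f s))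
when-sumSub (yes _) f = refl
when-sumSub {k = k} (no _) f = sym (sumSub-zero {k} (λ _ → refl))

sumFin-sumSub : ∀ {k j} (f : Fin k → Subset j → ℚ) →
                sumFin (λ i → sumSub (f i)) ≡ sumSub (λ s → sumFin (λ i → f i s))
sumFin-sumSub {zero} {j} f = sym (sumSub-zero {j} (λ _ → refl))
sumFin-sumSub {suc k} f = trans (cong (sumSub (f zero) +_) (sumFin-sumSub (λ i → f (suc i))))
  (sym (sumSub-+ (f zero) _))

sumSub-insert : ∀ {k} (i : Fin k) (f : Subset k → ℚ) →
                sumSub (λ s → when (i ∈? s) (f s)) ≡ sumSub (λ s → when (¬? (i ∈? s)) (f (s ∪ ⁅ i ⁆)))
sumSub-insert {suc k} zero f =
  trans (ℚ.+-comm _ (sumSub {k} (λ _ → 0ℚ)))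
    (cong (sumSub {k} (λ _ → 0ℚ) +_) (sumSub-cong (λ s → cong (λ p → f (inside ∷ p)) (sym (∪-identityʳ s)))))
sumSub-insert (suc i) f =
  cong₂ _+_ (sumSub-insert i (λ s → f (inside ∷ s))) (sumSub-insert i (λ s → f (outside ∷ s)))

indicator : Dec A → ℕ
indicator d = if does d then 1 else 0

indicator-yes : ∀ (d : Dec A) → A → indicator d ≡ 1
indicator-yes d a rewrite dec-true d a = refl

indicator-no : ∀ (d : Dec A) → ¬ A → indicator d ≡ 0
indicator-no d ¬a rewrite dec-false d ¬a = refl

indicator-split : ∀ (d : Dec A) (e : Dec B) → (B → A) → indicator d ≡ indicator e ℕ.+ indicator (d ×-dec ¬? e)
indicator-split (yes _) (yes _) _   = refl
indicator-split (yes _) (no _)  _   = refl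
indicator-split (no ¬a) (yes b) B→A = ⊥-elim (¬a (B→A b))
indicator-split (no _)  (no _)  _   = refl

countFin-cong : ∀ {k} {f g : Fin k → ℕ} → (∀ i → f i ≡ g i) → countFin f ≡ countFin g
countFin-cong {zero}  f≗g = refl
countFin-cong {suc k} f≗g = cong₂ ℕ._+_ (f≗g zero) (countFin-cong (λ i → f≗g (suc i)))

countFin-+ : ∀ {k} (f g : Fin k → ℕ) → countFin (λ i → f i ℕ.+ g i) ≡ countFin f ℕ.+ countFin g
countFin-+ {zero}  f g = refl
countFin-+ {suc k} f g = trans (cong (f zero ℕ.+ g zero ℕ.+_) (countFin-+ (λ i → f (suc i)) (λ i → g (suc i))))
  (ℕ+.interchange (f zero) (g zero) _ _)

countFin-zero : ∀ {k} {f : Fin k → ℕ} → (∀ i → f i ≡ 0) → countFin f ≡ 0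
countFin-zero {zero}  f≗0 = refl
countFin-zero {suc k} f≗0 = cong₂ ℕ._+_ (f≗0 zero) (countFin-zero (λ i → f≗0 (suc i)))

countFin-single : ∀ {k} {f : Fin k → ℕ} j → (∀ i → i ≢ j → f i ≡ 0) → countFin f ≡ f j
countFin-single {suc k} {f} zero f≗0 =
  trans (cong (f zero ℕ.+_) (countFin-zero (λ i → f≗0 (suc i) λ ()))) (ℕ.+-identityʳ (f zero))
countFin-single {suc k} {f} (suc j) f≗0 =
  trans (cong (ℕ._+ countFin (λ i → f (suc i))) (f≗0 zero λ ()))
    (countFin-single j (λ i i≢j → f≗0 (suc i) (λ eq → i≢j (suc-injective eq))))

countFin-pos : ∀ {k} (f : Fin k → ℕ) j → 1 ℕ.≤ f j → 1 ℕ.≤ countFin f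
countFin-pos {suc k} f zero    1≤fj = ℕ.≤-trans 1≤fj (ℕ.m≤m+n (f zero) _)
countFin-pos {suc k} f (suc j) 1≤fj = ℕ.≤-trans (countFin-pos (λ i → f (suc i)) j 1≤fj) (ℕ.m≤n+m _ (f zero))

fromℕ : ℕ → ℚ
fromℕ zero    = 0ℚ
fromℕ (suc k) = 1ℚ + fromℕ k

fromℕ-+ : ∀ a b → fromℕ (a ℕ.+ b) ≡ fromℕ a + fromℕ b
fromℕ-+ zero    b = sym (ℚ.+-identityˡ _)
fromℕ-+ (suc a) b = trans (cong (1ℚ +_) (fromℕ-+ a b)) (sym (ℚ.+-assoc 1ℚ (fromℕ a) (fromℕ b)))

fromℕ-countFin : ∀ {k} (f : Fin k → ℕ) → fromℕ (countFin f) ≡ sumFin (λ i → fromℕ (f i))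
fromℕ-countFin {zero}  f = refl
fromℕ-countFin {suc k} f = trans (fromℕ-+ (f zero) _) (cong (fromℕ (f zero) +_) (fromℕ-countFin (λ i → f (suc i))))

fromℕ-indicator : ∀ (d : Dec A) → fromℕ (indicator d) ≡ when d 1ℚ
fromℕ-indicator (yes _) = ℚ.+-identityʳ 1ℚ
fromℕ-indicator (no _)  = refl

inv-*-fromℕ : ∀ {k} → 1 ℕ.≤ k → inv k * fromℕ k ≡ 1ℚ
inv-*-fromℕ {suc k} _ = trans (cong₂ _*_ (ℚ.↥p/↧p≡p (1/ q)) (fromℕ≡q (suc k))) (ℚ.*-inverseˡ q)
  where
  q : ℚ
  q = mkℚ (ℤ.+ suc k) 0 (coprime-sym (1-coprimeTo (suc k)))
  fromℕ≡q : ∀ j → fromℕ j ≡ mkℚ (ℤ.+ j) 0 (coprime-sym (1-coprimeTo j))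
  fromℕ≡q zero    = ℚ.↥p/↧p≡p 0ℚ
  fromℕ≡q (suc j) = trans (cong (1ℚ +_) (fromℕ≡q j))
    (trans (cong (λ i → (ℤ.+ 1 ℤ.+ i) / 1) (ℤ.*-identityʳ (ℤ.+ j))) (ℚ.↥p/↧p≡p _))

-- Defs builds sumSubWhere, prodIn and classSize from guards local to where blocks; each
-- …-summand/…-factor lemma leaves that term as _, solved by its use in the lemma right after it.
sumSubWhere-summand : ∀ {k} {P : Subset k → Set} (P? : ∀ s → Dec (P s)) (f : Subset k → ℚ) s →
                      _ ≡ when (P? s) (f s)

sumSubWhere-when : ∀ {k} {P : Subset k → Set} (P? : ∀ s → Dec (P s)) (f : Subset k → ℚ) →
                   sumSubWhere P? f ≡ sumSub (λ s → when (P? s) (f s))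
sumSubWhere-when P? f = sumSub-cong (sumSubWhere-summand P? f)

sumSubWhere-summand P? f s with P? s
... | yes _ = refl
... | no _  = refl

prodIn-factor : ∀ {k} (S : Subset k) (f : Fin k → ℚ) u → _ ≡ (if does (u ∈? S) then f u else 1ℚ)

prodIn-if : ∀ {k} (S : Subset k) (f : Fin k → ℚ) → prodIn S f ≡ prodFin (λ u → if does (u ∈? S) then f u else 1ℚ)
prodIn-if S f = prodFin-cong (prodIn-factor S f)

prodIn-factor S f u with u ∈? S
... | yes _ = refl
... | no _  = refl

prodIn-⊥ : ∀ {k} (f : Fin k → ℚ) → prodIn ⊥ f ≡ 1ℚ
prodIn-⊥ f = trans (prodIn-if ⊥ f) (prodFin-one (λ u → if-no (u ∈? ⊥) {f u} ∉⊥))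

prodIn-∪⁅⁆ : ∀ {k} (S : Subset k) (f : Fin k → ℚ) {u} → u ∉ S → prodIn (S ∪ ⁅ u ⁆) f ≡ prodIn S f * f u
prodIn-∪⁅⁆ S f {u} u∉S = begin
  prodIn (S ∪ ⁅ u ⁆) f
    ≡⟨ prodIn-if (S ∪ ⁅ u ⁆) f ⟩
  prodFin (λ w → if does (w ∈? S ∪ ⁅ u ⁆) then f w else 1ℚ)
    ≡⟨ prodFin-extract u (if-no (u ∈? S) u∉S) others ⟩
  (if does (u ∈? S ∪ ⁅ u ⁆) then f u else 1ℚ) * prodFin (λ w → if does (w ∈? S) then f w else 1ℚ)
    ≡⟨ cong₂ _*_ (if-yes (u ∈? S ∪ ⁅ u ⁆) (q⊆p∪q S ⁅ u ⁆ (x∈⁅x⁆ u))) (sym (prodIn-if S f)) ⟩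
  f u * prodIn S f
    ≡⟨ ℚ.*-comm (f u) _ ⟩
  prodIn S f * f u
    ∎
  where
  open ≡-Reasoning
  others : ∀ w → w ≢ u → (if does (w ∈? S ∪ ⁅ u ⁆) then f w else 1ℚ) ≡ (if does (w ∈? S) then f w else 1ℚ)
  others w w≢u = if-⇔ (w ∈? S ∪ ⁅ u ⁆) (w ∈? S)
    (λ w∈ → [ (λ w∈S → w∈S) , (λ w∈u → ⊥-elim (w≢u (x∈⁅y⁆⇒x≡y u w∈u))) ]′ (x∈p∪q⁻ S ⁅ u ⁆ w∈)) (p⊆p∪q ⁅ u ⁆)

classSize-summand : ∀ {k j} (cls : Fin k → Fin j) ω u → _ ≡ indicator (cls u ≟ᶠ ω)

classSize-countFin : ∀ {k j} (cls : Fin k → Fin j) ω → classSize cls ω ≡ countFin (λ u → indicator (cls u ≟ᶠ ω))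
classSize-countFin cls ω = countFin-cong (classSize-summand cls ω)

classSize-summand cls ω u with cls u ≟ᶠ ω
... | yes _ = refl
... | no _  = refl

select : ∀ {k} {P : Fin k → Set} → (∀ i → Dec (P i)) → Subset k
select {zero}  P? = []
select {suc k} P? = does (P? zero) ∷ select (λ i → P? (suc i))

∈-select⁻ : ∀ {k} {P : Fin k → Set} (P? : ∀ i → Dec (P i)) {i} → i ∈ select P? → P i
∈-select⁻ {suc k} P? {zero} i∈ with P? zero | i∈
... | yes p | _ = p
∈-select⁻ {suc k} P? {suc i} (there i∈) = ∈-select⁻ (λ j → P? (suc j)) i∈

∈-select⁺ : ∀ {k} {P : Fin k → Set} (P? : ∀ i → Dec (P i)) {i} → P i → i ∈ select P?
∈-select⁺ {suc k} P? {zero} p with P? zero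
... | yes _ = here
... | no ¬p = ⊥-elim (¬p p)
∈-select⁺ {suc k} P? {suc i} p = there (∈-select⁺ (λ j → P? (suc j)) p)

x∈p─q⁻ : ∀ {k} {x : Fin k} (p q : Subset k) → x ∈ p ─ q → x ∈ p × x ∉ q
x∈p─q⁻ {x = zero} (inside ∷ p)  (outside ∷ q) here = here , λ ()
x∈p─q⁻ {x = zero} (inside ∷ p)  (inside ∷ q)  ()
x∈p─q⁻ {x = zero} (outside ∷ p) (inside ∷ q)  ()
x∈p─q⁻ {x = zero} (outside ∷ p) (outside ∷ q) ()
x∈p─q⁻ {x = suc x} (s ∷ p) (t ∷ q) (there x∈) = Product.map there (λ x∉q x∈q → x∉q (drop-there x∈q)) (x∈p─q⁻ p q x∈)

∣p∪q∣≡∣p∣+∣q∣ : ∀ {k} (p q : Subset k) → (∀ {x} → x ∈ p → x ∉ q) → ∣ p ∪ q ∣ ≡ ∣ p ∣ ℕ.+ ∣ q ∣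
∣p∪q∣≡∣p∣+∣q∣ []           []           _    = refl
∣p∪q∣≡∣p∣+∣q∣ (inside ∷ p)  (inside ∷ q)  disj = ⊥-elim (disj here here)
∣p∪q∣≡∣p∣+∣q∣ (inside ∷ p)  (outside ∷ q) disj =
  cong suc (∣p∪q∣≡∣p∣+∣q∣ p q (λ x∈p x∈q → disj (there x∈p) (there x∈q)))
∣p∪q∣≡∣p∣+∣q∣ (outside ∷ p) (inside ∷ q)  disj =
  trans (cong suc (∣p∪q∣≡∣p∣+∣q∣ p q (λ x∈p x∈q → disj (there x∈p) (there x∈q)))) (sym (ℕ.+-suc ∣ p ∣ ∣ q ∣))
∣p∪q∣≡∣p∣+∣q∣ (outside ∷ p) (outside ∷ q) disj = ∣p∪q∣≡∣p∣+∣q∣ p q (λ x∈p x∈q → disj (there x∈p) (there x∈q))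

∣p∪⁅x⁆∣≡1+∣p∣ : ∀ {k} (p : Subset k) {x} → x ∉ p → ∣ p ∪ ⁅ x ⁆ ∣ ≡ suc ∣ p ∣
∣p∪⁅x⁆∣≡1+∣p∣ p {x} x∉p =
  trans (∣p∪q∣≡∣p∣+∣q∣ p ⁅ x ⁆ (λ y∈p y∈⁅x⁆ → x∉p (subst (_∈ p) (x∈⁅y⁆⇒x≡y x y∈⁅x⁆) y∈p)))
    (trans (cong (∣ p ∣ ℕ.+_) (∣⁅x⁆∣≡1 x)) (ℕ.+-comm ∣ p ∣ 1))

p∪[q─p]≡q : ∀ {k} {p q : Subset k} → p ⊆ q → p ∪ (q ─ p) ≡ q
p∪[q─p]≡q {p = p} {q} p⊆q = ⊆-antisym
  (λ x∈ → [ p⊆q , (λ x∈q─p → proj₁ (x∈p─q⁻ q p x∈q─p)) ]′ (x∈p∪q⁻ p (q ─ p) x∈))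
  (λ {x} x∈q → case x ∈? p of λ where
     (yes x∈p) → p⊆p∪q (q ─ p) x∈p
     (no x∉p)  → q⊆p∪q p (q ─ p) (x∈p∧x∉q⇒x∈p─q x∈q x∉p))

∣q∣≡∣p∣+∣q─p∣ : ∀ {k} {p q : Subset k} → p ⊆ q → ∣ q ∣ ≡ ∣ p ∣ ℕ.+ ∣ q ─ p ∣
∣q∣≡∣p∣+∣q─p∣ {p = p} {q} p⊆q =
  trans (cong ∣_∣ (sym (p∪[q─p]≡q p⊆q))) (∣p∪q∣≡∣p∣+∣q∣ p (q ─ p) (λ x∈p x∈q─p → proj₂ (x∈p─q⁻ q p x∈q─p) x∈p))

⊆∧≢⇒⊂ : ∀ {k} {p q : Subset k} → p ⊆ q → p ≢ q → p ⊂ q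
⊆∧≢⇒⊂ {p = p} {q} p⊆q p≢q with any? (λ x → (x ∈? q) ×-dec ¬? (x ∈? p))
... | yes witness = p⊆q , witness
... | no ¬witness = ⊥-elim (p≢q (⊆-antisym p⊆q λ {x} x∈q →
        decidable-stable (x ∈? p) λ x∉p → ¬witness (x , x∈q , x∉p)))

∣p∣≡1+∣p-x∣ : ∀ {k} {p : Subset k} {x} → x ∈ p → ∣ p ∣ ≡ suc ∣ p - x ∣
∣p∣≡1+∣p-x∣ {p = p} {x} x∈p = trans (∣q∣≡∣p∣+∣q─p∣ (λ y∈⁅x⁆ → subst (_∈ _) (sym (x∈⁅y⁆⇒x≡y x y∈⁅x⁆)) x∈p))
  (cong (ℕ._+ ∣ p - x ∣) (∣⁅x⁆∣≡1 x))

module MultimatroidProperties {n m : ℕ} (Z : Multimatroid n m) where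
  open Multimatroid Z
  open IsMatroidRankOn

  Subtr : Subset n → Set
  Subtr = Subtransversal cls

  Meets : Subset n → Fin m → Set
  Meets S ω = ∃ λ u → u ∈ S × cls u ≡ ω

  meets? : ∀ S ω → Dec (Meets S ω)
  meets? S ω = any? (λ u → (u ∈? S) ×-dec (cls u ≟ᶠ ω))

  Meets-mono : ∀ {S S' ω} → S ⊆ S' → Meets S ω → Meets S' ω
  Meets-mono S⊆S' (u , u∈S , cls-u) = u , S⊆S' u∈S , cls-u

  Meets-∪⁅⁆⁻ : ∀ {X u ω} → Meets (X ∪ ⁅ u ⁆) ω → Meets X ω ⊎ cls u ≡ ω
  Meets-∪⁅⁆⁻ {X} {u} (w , w∈ , cls-w) with x∈p∪q⁻ X ⁅ u ⁆ w∈
  ... | inj₁ w∈X = inj₁ (w , w∈X , cls-w)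
  ... | inj₂ w∈u = inj₂ (trans (cong cls (sym (x∈⁅y⁆⇒x≡y u w∈u))) cls-w)

  Meets-∪⁅⁆ : ∀ X u → Meets (X ∪ ⁅ u ⁆) (cls u)
  Meets-∪⁅⁆ X u = u , q⊆p∪q X ⁅ u ⁆ (x∈⁅x⁆ u) , refl

  Subtr-⊆ : ∀ {X Y} → Subtr Y → X ⊆ Y → Subtr X
  Subtr-⊆ stY X⊆Y a b a∈X b∈X = stY a b (X⊆Y a∈X) (X⊆Y b∈X)

  Subtr-⊥ : Subtr ⊥
  Subtr-⊥ a b a∈⊥ = ⊥-elim (∉⊥ a∈⊥)

  Subtr-∪ : ∀ {X Y} → Subtr X → Subtr Y → (∀ {a b} → a ∈ X → b ∈ Y → cls a ≢ cls b) → Subtr (X ∪ Y)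
  Subtr-∪ {X} {Y} stX stY apart a b a∈ b∈ eq with x∈p∪q⁻ X Y a∈ | x∈p∪q⁻ X Y b∈
  ... | inj₁ a∈X | inj₁ b∈X = stX a b a∈X b∈X eq
  ... | inj₁ a∈X | inj₂ b∈Y = ⊥-elim (apart a∈X b∈Y eq)
  ... | inj₂ a∈Y | inj₁ b∈X = ⊥-elim (apart b∈X a∈Y (sym eq))
  ... | inj₂ a∈Y | inj₂ b∈Y = stY a b a∈Y b∈Y eq

  Subtr-∪⁅⁆ : ∀ {X} u → Subtr X → ¬ Meets X (cls u) → Subtr (X ∪ ⁅ u ⁆)
  Subtr-∪⁅⁆ {X} u stX ¬meets = Subtr-∪ stX singleton
    (λ {a} a∈X b∈⁅u⁆ eq → ¬meets (a , a∈X , trans eq (cong cls (x∈⁅y⁆⇒x≡y u b∈⁅u⁆))))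
    where
    singleton : Subtr ⁅ u ⁆
    singleton a b a∈ b∈ _ = trans (x∈⁅y⁆⇒x≡y u a∈) (sym (x∈⁅y⁆⇒x≡y u b∈))

  extendToTransversal : ∀ {S} → Subtr S → ∃ λ T → Transversal cls T × S ⊆ T
  extendToTransversal {S} stS = T , (stT , covers) , (λ u∈S → ∈-select⁺ T? (inj₁ u∈S))
    where
    rep : Fin m → Fin n
    rep ω = proj₁ (nonempty ω)
    T? : ∀ u → Dec (u ∈ S ⊎ (¬ Meets S (cls u) × u ≡ rep (cls u)))
    T? u = (u ∈? S) ⊎-dec (¬? (meets? S (cls u)) ×-dec (u ≟ᶠ rep (cls u)))
    T : Subset n
    T = select T?
    stT : Subtr T
    stT a b a∈ b∈ eq with ∈-select⁻ T? a∈ | ∈-select⁻ T? b∈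
    ... | inj₁ a∈S         | inj₁ b∈S         = stS a b a∈S b∈S eq
    ... | inj₁ a∈S         | inj₂ (¬meets , _) = ⊥-elim (¬meets (a , a∈S , eq))
    ... | inj₂ (¬meets , _) | inj₁ b∈S         = ⊥-elim (¬meets (b , b∈S , sym eq))
    ... | inj₂ (_ , a≡rep) | inj₂ (_ , b≡rep) = trans a≡rep (trans (cong rep eq) (sym b≡rep))
    covers : ∀ ω → Meets T ω
    covers ω with meets? S ω
    ... | yes (u , u∈S , cls-u) = u , ∈-select⁺ T? (inj₁ u∈S) , cls-u
    ... | no ¬meets = rep ω , ∈-select⁺ T? (inj₂ (subst (λ ω′ → ¬ Meets S ω′) (sym cls-rep) ¬meets ,
                                                   cong rep (sym cls-rep))) , cls-rep
      where
      cls-rep : cls (rep ω) ≡ ω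
      cls-rep = proj₂ (nonempty ω)

  r-bounded : ∀ {X} → Subtr X → r X ℕ.≤ ∣ X ∣
  r-bounded stX with extendToTransversal stX
  ... | T , isT , X⊆T = bounded (R1 T isT) _ X⊆T

  r-monotone : ∀ {X Y} → Subtr Y → X ⊆ Y → r X ℕ.≤ r Y
  r-monotone stY X⊆Y with extendToTransversal stY
  ... | T , isT , Y⊆T = monotone (R1 T isT) _ _ (λ x∈ → Y⊆T (X⊆Y x∈)) Y⊆T X⊆Y

  r-submodular : ∀ {U X Y I} → Subtr U → X ⊆ U → Y ⊆ U → U ⊆ X ∪ Y → I ⊆ X → I ⊆ Y →
                 r U ℕ.+ r I ℕ.≤ r X ℕ.+ r Y
  r-submodular {U} {X} {Y} {I} stU X⊆U Y⊆U U⊆X∪Y I⊆X I⊆Y with extendToTransversal stU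
  ... | T , isT , U⊆T = ℕ.≤-trans
          (ℕ.+-mono-≤ (ℕ.≤-reflexive (cong r U≡X∪Y)) (monotone (R1 T isT) _ _ (λ i∈ → U⊆T (X⊆U (I⊆X i∈)))
             (λ i∈ → U⊆T (X⊆U (proj₁ (x∈p∩q⁻ X Y i∈)))) (λ i∈ → x∈p∩q⁺ (I⊆X i∈ , I⊆Y i∈))))
          (submodular (R1 T isT) X Y (λ x∈ → U⊆T (X⊆U x∈)) (λ y∈ → U⊆T (Y⊆U y∈)))
    where
    U≡X∪Y : U ≡ X ∪ Y
    U≡X∪Y = ⊆-antisym U⊆X∪Y (λ x∈ → [ X⊆U , Y⊆U ]′ (x∈p∪q⁻ X Y x∈))

  r-⊥ : r ⊥ ≡ 0
  r-⊥ = ℕ.n≤0⇒n≡0 (ℕ.≤-trans (r-bounded Subtr-⊥) (ℕ.≤-reflexive (∣⊥∣≡0 n)))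

  r-∪-≤ : ∀ {X Y} → Subtr (X ∪ Y) → r (X ∪ Y) ℕ.≤ r X ℕ.+ ∣ Y ∣
  r-∪-≤ {X} {Y} stX∪Y = begin
    r (X ∪ Y)           ≡⟨ ℕ.+-identityʳ _ ⟨
    r (X ∪ Y) ℕ.+ 0     ≡⟨ cong (r (X ∪ Y) ℕ.+_) r-⊥ ⟨
    r (X ∪ Y) ℕ.+ r ⊥   ≤⟨ r-submodular stX∪Y (p⊆p∪q Y) (q⊆p∪q X Y) (λ x∈ → x∈) (λ x∈ → ⊥-elim (∉⊥ x∈))
                                                                             (λ x∈ → ⊥-elim (∉⊥ x∈)) ⟩
    r X ℕ.+ r Y         ≤⟨ ℕ.+-monoʳ-≤ (r X) (r-bounded (Subtr-⊆ stX∪Y (q⊆p∪q X Y))) ⟩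
    r X ℕ.+ ∣ Y ∣       ∎
    where open ℕ.≤-Reasoning

  r-∪⁅⁆-≤ : ∀ {X} u → Subtr (X ∪ ⁅ u ⁆) → r (X ∪ ⁅ u ⁆) ℕ.≤ suc (r X)
  r-∪⁅⁆-≤ {X} u st = ℕ.≤-trans (r-∪-≤ st) (ℕ.≤-reflexive (trans (cong (r X ℕ.+_) (∣⁅x⁆∣≡1 u)) (ℕ.+-comm (r X) 1)))

  Independent-⊆ : ∀ {X B} → Independent Z B → X ⊆ B → Independent Z X
  Independent-⊆ {X} {B} (stB , rB) X⊆B = stX , ℕ.≤-antisym (r-bounded stX) (ℕ.+-cancelʳ-≤ _ _ _ (begin
    ∣ X ∣ ℕ.+ ∣ B ─ X ∣   ≡⟨ trans rB (∣q∣≡∣p∣+∣q─p∣ X⊆B) ⟨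
    r B                   ≡⟨ cong r (p∪[q─p]≡q X⊆B) ⟨
    r (X ∪ (B ─ X))       ≤⟨ r-∪-≤ (subst Subtr (sym (p∪[q─p]≡q X⊆B)) stB) ⟩
    r X ℕ.+ ∣ B ─ X ∣     ∎))
    where
    open ℕ.≤-Reasoning
    stX : Subtr X
    stX = Subtr-⊆ stB X⊆B

  Loop : Subset n → Fin n → Set
  Loop X v = r (X ∪ ⁅ v ⁆) ≡ r X

  loop? : ∀ X v → Dec (Loop X v)
  loop? X v = r (X ∪ ⁅ v ⁆) ℕ.≟ r X

  R2-apart : ∀ {X a b} → Subtr X → ¬ Meets X (cls a) → cls a ≡ cls b → a ≢ b →
             suc (r X ℕ.+ r X) ℕ.≤ r (X ∪ ⁅ a ⁆) ℕ.+ r (X ∪ ⁅ b ⁆)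
  R2-apart {X} {a} {b} stX ¬meets cls-ab a≢b =
    subst (λ k → suc k ℕ.≤ r (X ∪ ⁅ a ⁆) ℕ.+ r (X ∪ ⁅ b ⁆)) (cong (r X ℕ.+_) (ℕ.+-identityʳ (r X)))
      (R2 X a b stX a≢b cls-ab (λ z z∈X cls-z → ¬meets (z , z∈X , cls-z)))

  loop-unique : ∀ {X a b} → Subtr X → ¬ Meets X (cls a) → cls a ≡ cls b → Loop X a → Loop X b → a ≡ b
  loop-unique {X} {a} {b} stX ¬meets cls-ab loop-a loop-b = decidable-stable (a ≟ᶠ b) λ a≢b →
    ℕ.<-irrefl (sym (cong₂ ℕ._+_ loop-a loop-b)) (R2-apart stX ¬meets cls-ab a≢b)

  nonloop-rank : ∀ {X u} → Subtr X → ¬ Meets X (cls u) → ¬ Loop X u → r (X ∪ ⁅ u ⁆) ≡ suc (r X)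
  nonloop-rank {X} {u} stX ¬meets ¬loop = ℕ.≤-antisym (r-∪⁅⁆-≤ u stX∪u)
    (ℕ.≤∧≢⇒< (r-monotone stX∪u (p⊆p∪q ⁅ u ⁆)) (λ eq → ¬loop (sym eq)))
    where
    stX∪u = Subtr-∪⁅⁆ u stX ¬meets

  beside-loop-rank : ∀ {X u v} → Subtr X → ¬ Meets X (cls v) → Loop X v → cls u ≡ cls v → u ≢ v →
                     r (X ∪ ⁅ u ⁆) ≡ suc (r X)
  beside-loop-rank {X} {u} {v} stX ¬meets loop-v cls-uv u≢v = nonloop-rank stX ¬meets-u λ loop-u →
    u≢v (loop-unique stX ¬meets-u cls-uv loop-u loop-v)
    where
    ¬meets-u : ¬ Meets X (cls u)
    ¬meets-u = subst (λ ω → ¬ Meets X ω) (sym cls-uv) ¬meets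

  Loop-⊆ : ∀ {P X v} → Subtr (X ∪ ⁅ v ⁆) → P ⊆ X → Loop P v → Loop X v
  Loop-⊆ {P} {X} {v} stX∪v P⊆X loop-v = ℕ.≤-antisym (ℕ.+-cancelʳ-≤ (r P) _ _ (begin
    r (X ∪ ⁅ v ⁆) ℕ.+ r P          ≤⟨ r-submodular stX∪v (p⊆p∪q ⁅ v ⁆) P∪v⊆ X∪v⊆ P⊆X (p⊆p∪q ⁅ v ⁆) ⟩
    r X ℕ.+ r (P ∪ ⁅ v ⁆)          ≡⟨ cong (r X ℕ.+_) loop-v ⟩
    r X ℕ.+ r P                    ∎))
    (r-monotone stX∪v (p⊆p∪q ⁅ v ⁆))
    where
    open ℕ.≤-Reasoning
    P∪v⊆ : P ∪ ⁅ v ⁆ ⊆ X ∪ ⁅ v ⁆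
    P∪v⊆ x∈ = [ (λ x∈P → p⊆p∪q ⁅ v ⁆ (P⊆X x∈P)) , q⊆p∪q X ⁅ v ⁆ ]′ (x∈p∪q⁻ P ⁅ v ⁆ x∈)
    X∪v⊆ : X ∪ ⁅ v ⁆ ⊆ X ∪ (P ∪ ⁅ v ⁆)
    X∪v⊆ x∈ = [ p⊆p∪q _ , (λ x∈v → q⊆p∪q X _ (q⊆p∪q P ⁅ v ⁆ x∈v)) ]′ (x∈p∪q⁻ X ⁅ v ⁆ x∈)

  -- v stays a loop over every X ⊇ P (Loop-⊆), and then no other element of its class is one (R2)
  loop-shift : ∀ {P X u v} → Subtr X → ¬ Meets X (cls v) → P ⊆ X → Loop P v → cls u ≡ cls v → u ≢ v →
               r (X ∪ ⁅ u ⁆) ≡ suc (r (X ∪ ⁅ v ⁆))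
  loop-shift {P} {X} {u} {v} stX ¬meets P⊆X loop-v cls-uv u≢v =
    trans (beside-loop-rank stX ¬meets loop-X cls-uv u≢v) (cong suc (sym loop-X))
    where
    loop-X : Loop X v
    loop-X = Loop-⊆ (Subtr-∪⁅⁆ v stX ¬meets) P⊆X loop-v

  Loop-shift⇔ : ∀ {X u v y} → r (X ∪ ⁅ u ⁆) ≡ suc (r (X ∪ ⁅ v ⁆)) →
                r ((X ∪ ⁅ y ⁆) ∪ ⁅ u ⁆) ≡ suc (r ((X ∪ ⁅ y ⁆) ∪ ⁅ v ⁆)) →
                (Loop (X ∪ ⁅ u ⁆) y → Loop (X ∪ ⁅ v ⁆) y) × (Loop (X ∪ ⁅ v ⁆) y → Loop (X ∪ ⁅ u ⁆) y)
  Loop-shift⇔ {X} {u} {v} {y} gap gap-y =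
    (λ loop → ℕ.suc-injective (trans (sym shifted-gap) (trans loop gap))) ,
    (λ loop → trans shifted-gap (trans (cong suc loop) (sym gap)))
    where
    swap : ∀ b → (X ∪ ⁅ b ⁆) ∪ ⁅ y ⁆ ≡ (X ∪ ⁅ y ⁆) ∪ ⁅ b ⁆
    swap b = trans (∪-assoc X ⁅ b ⁆ ⁅ y ⁆) (trans (cong (X ∪_) (∪-comm ⁅ b ⁆ ⁅ y ⁆)) (sym (∪-assoc X ⁅ y ⁆ ⁅ b ⁆)))
    shifted-gap : r ((X ∪ ⁅ u ⁆) ∪ ⁅ y ⁆) ≡ suc (r ((X ∪ ⁅ v ⁆) ∪ ⁅ y ⁆))
    shifted-gap = trans (cong r (swap u)) (trans gap-y (cong (λ Y → suc (r Y)) (sym (swap v))))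

  Independent-∪⁅⁆ : ∀ {X u} → Independent Z X → ¬ Meets X (cls u) → ¬ Loop X u → Independent Z (X ∪ ⁅ u ⁆)
  Independent-∪⁅⁆ {X} {u} (stX , rX) ¬meets ¬loop = Subtr-∪⁅⁆ u stX ¬meets ,
    trans (nonloop-rank stX ¬meets ¬loop)
      (trans (cong suc rX) (sym (∣p∪⁅x⁆∣≡1+∣p∣ X (λ u∈X → ¬meets (u , u∈X , refl)))))

  Loop⇒¬Independent : ∀ {A v} → Independent Z A → v ∉ A → Loop A v → ¬ Independent Z (A ∪ ⁅ v ⁆)
  Loop⇒¬Independent {A} {v} (_ , rA) v∉A loop (_ , rA∪v) =
    ℕ.1+n≢n (trans (sym (trans rA∪v (∣p∪⁅x⁆∣≡1+∣p∣ A v∉A))) (trans loop rA))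

  circuit-⊆ : ∀ {D} → Subtr D → r D ≢ ∣ D ∣ → ∃ λ C → Circuit Z C × C ⊆ D
  circuit-⊆ {D} = go (⊂-wellFounded D)
    where
    go : ∀ {D} → Acc _⊂_ D → Subtr D → r D ≢ ∣ D ∣ → ∃ λ C → Circuit Z C × C ⊆ D
    go {D} (acc smaller) stD depD
      with anySubset? (λ D′ → (D′ ⊆? D) ×-dec ¬? (≡-dec _≟ᵇ_ D′ D) ×-dec ¬? (r D′ ℕ.≟ ∣ D′ ∣))
    ... | no ¬dep-below = D , (stD , depD , minimal) , (λ x∈ → x∈)
      where
      minimal : ∀ D′ → D′ ⊆ D → D′ ≢ D → r D′ ≡ ∣ D′ ∣
      minimal D′ D′⊆D D′≢D = decidable-stable (r D′ ℕ.≟ ∣ D′ ∣) λ dep′ → ¬dep-below (D′ , D′⊆D , D′≢D , dep′)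
    ... | yes (D′ , D′⊆D , D′≢D , dep′) with go (smaller (⊆∧≢⇒⊂ D′⊆D D′≢D)) (Subtr-⊆ stD D′⊆D) dep′
    ...   | C , circuit , C⊆D′ = C , circuit , (λ x∈ → D′⊆D (C⊆D′ x∈))

  Circuit⇒¬⊆Independent : ∀ {C B} → Circuit Z C → Independent Z B → ¬ C ⊆ B
  Circuit⇒¬⊆Independent (_ , depC , _) indB C⊆B = depC (proj₂ (Independent-⊆ indB C⊆B))

  circuit-rank : ∀ {C c} → Circuit Z C → c ∈ C → r C ≡ ∣ C - c ∣
  circuit-rank {C} {c} (stC , depC , minimal) c∈C = ℕ.≤-antisym
    (ℕ.≤-pred (ℕ.≤∧≢⇒< (subst (r C ℕ.≤_) (∣p∣≡1+∣p-x∣ c∈C) (r-bounded stC))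
                        (λ eq → depC (trans eq (sym (∣p∣≡1+∣p-x∣ c∈C))))))
    (subst (ℕ._≤ r C) (minimal (C - c) (p─q⊆p C ⁅ c ⁆) (λ eq → c∉C-c (subst (c ∈_) (sym eq) c∈C)))
       (r-monotone stC (p─q⊆p C ⁅ c ⁆)))
    where
    c∉C-c : c ∉ C - c
    c∉C-c c∈ = proj₂ (x∈p─q⁻ C ⁅ c ⁆ c∈) (x∈⁅x⁆ c)

  circuit-spans : ∀ {C X c} → Circuit Z C → Subtr X → C ⊆ X → c ∈ C → r X ℕ.≤ r (X - c)
  circuit-spans {C} {X} {c} circuit stX C⊆X c∈C = ℕ.+-cancelʳ-≤ (r (C - c)) _ _ (begin
    r X ℕ.+ r (C - c)        ≤⟨ r-submodular stX (p─q⊆p X ⁅ c ⁆) C⊆X X⊆ C-c⊆X-c (p─q⊆p C ⁅ c ⁆) ⟩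
    r (X - c) ℕ.+ r C        ≡⟨ cong (r (X - c) ℕ.+_) (trans (circuit-rank circuit c∈C) (sym rC-c)) ⟩
    r (X - c) ℕ.+ r (C - c)  ∎)
    where
    open ℕ.≤-Reasoning
    rC-c : r (C - c) ≡ ∣ C - c ∣
    rC-c = proj₂ (proj₂ circuit) (C - c) (p─q⊆p C ⁅ c ⁆) λ eq →
      proj₂ (x∈p─q⁻ C ⁅ c ⁆ (subst (c ∈_) (sym eq) c∈C)) (x∈⁅x⁆ c)
    X⊆ : X ⊆ (X - c) ∪ C
    X⊆ {x} x∈X with x ≟ᶠ c
    ... | yes refl = q⊆p∪q (X - c) C c∈C
    ... | no x≢c = p⊆p∪q C (x∈p∧x≢y⇒x∈p-y x∈X x≢c)
    C-c⊆X-c : C - c ⊆ X - c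
    C-c⊆X-c x∈ = let x∈C , x∉c = x∈p─q⁻ C ⁅ c ⁆ x∈ in x∈p∧x∉q⇒x∈p─q (C⊆X x∈C) x∉c

  basis⇒transversal : NonDegenerate Z → ∀ {B} → Basis Z B → Transversal cls B
  basis⇒transversal nonDeg {B} (indB@(stB , _) , maximal) = stB , covers
    where
    covers : ∀ ω → Meets B ω
    covers ω = decidable-stable (meets? B ω) λ ¬meets →
      let a , b , a≢b , cls-a , cls-b = nonDeg ω
          ¬meets-a = subst (λ ω′ → ¬ Meets B ω′) (sym cls-a) ¬meets
      in a≢b (loop-unique stB ¬meets-a (trans cls-a (sym cls-b))
                (loop ¬meets-a) (loop (subst (λ ω′ → ¬ Meets B ω′) (sym cls-b) ¬meets)))
      where
      loop : ∀ {a} → ¬ Meets B (cls a) → Loop B a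
      loop {a} ¬meets-a = decidable-stable (loop? B a) λ ¬loop →
        ¬meets-a (a , subst (a ∈_) (maximal _ (Independent-∪⁅⁆ indB ¬meets-a ¬loop) (p⊆p∪q ⁅ a ⁆))
                                   (q⊆p∪q B ⁅ a ⁆ (x∈⁅x⁆ a)) , refl)

  transversal⇒basis : ∀ {B} → Transversal cls B → Independent Z B → Basis Z B
  transversal⇒basis {B} (_ , covers) indB = indB , λ S (stS , _) B⊆S → ⊆-antisym (S⊆B stS B⊆S) B⊆S
    where
    S⊆B : ∀ {S} → Subtr S → B ⊆ S → S ⊆ B
    S⊆B stS B⊆S {w} w∈S with covers (cls w)
    ... | b , b∈B , cls-b = subst (_∈ B) (stS b w (B⊆S b∈B) w∈S cls-b) b∈B

module Activity {n m : ℕ} (Z : Multimatroid n m) (_≺_ : Rel (Fin m) 0ℓ) (sto : IsStrictTotalOrder _≡_ _≺_)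
                (x : Fin n → ℚ) (t : ℚ) where
  open Multimatroid Z
  open MultimatroidProperties Z
  open IsStrictTotalOrder sto using (_<?_; compare) renaming (trans to ≺-trans; irrefl to ≺-irrefl)

  ≺-irrefl′ : ∀ {ω} → ¬ ω ≺ ω
  ≺-irrefl′ = ≺-irrefl refl

  Above : Subset n → Fin m → Subset n
  Above W ω = select (λ u → (u ∈? W) ×-dec (ω <? cls u))

  ∈-Above⁻ : ∀ {W ω u} → u ∈ Above W ω → u ∈ W × ω ≺ cls u
  ∈-Above⁻ = ∈-select⁻ _

  ∈-Above⁺ : ∀ {W ω u} → u ∈ W → ω ≺ cls u → u ∈ Above W ω
  ∈-Above⁺ u∈W ω≺u = ∈-select⁺ _ (u∈W , ω≺u)

  Above-⊆ : ∀ {W ω} → Above W ω ⊆ W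
  Above-⊆ u∈ = proj₁ (∈-Above⁻ u∈)

  ¬Meets-Above : ∀ {W ω} → ¬ Meets (Above W ω) ω
  ¬Meets-Above (u , u∈ , refl) = ≺-irrefl′ (proj₂ (∈-Above⁻ u∈))

  Above-∪⁅⁆ : ∀ {W ω b} → ω ≺ cls b → Above (W ∪ ⁅ b ⁆) ω ≡ Above W ω ∪ ⁅ b ⁆
  Above-∪⁅⁆ {W} {ω} {b} ω≺b = ⊆-antisym to from
    where
    to : Above (W ∪ ⁅ b ⁆) ω ⊆ Above W ω ∪ ⁅ b ⁆
    to u∈ with ∈-Above⁻ u∈
    ... | u∈W∪b , ω≺u =
      [ (λ u∈W → p⊆p∪q ⁅ b ⁆ (∈-Above⁺ u∈W ω≺u)) , q⊆p∪q (Above W ω) ⁅ b ⁆ ]′ (x∈p∪q⁻ W ⁅ b ⁆ u∈W∪b)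
    from : Above W ω ∪ ⁅ b ⁆ ⊆ Above (W ∪ ⁅ b ⁆) ω
    from {u} u∈ with x∈p∪q⁻ (Above W ω) ⁅ b ⁆ u∈
    ... | inj₁ u∈A = let u∈W , ω≺u = ∈-Above⁻ u∈A in ∈-Above⁺ (p⊆p∪q ⁅ b ⁆ u∈W) ω≺u
    ... | inj₂ u∈b rewrite x∈⁅y⁆⇒x≡y b u∈b = ∈-Above⁺ (q⊆p∪q W ⁅ b ⁆ (x∈⁅x⁆ b)) ω≺b

  classLoop? : ∀ A ω → Dec (∃ λ v → cls v ≡ ω × Loop A v)
  classLoop? A ω = any? (λ v → (cls v ≟ᶠ ω) ×-dec loop? A v)

  share : Fin m → ℚ
  share ω = inv (classSize cls ω ∸ 1)

  loopFactor : Subset n → Fin m → ℚ → ℚ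
  loopFactor A ω y with classLoop? A ω
  ... | yes (v , _) = (t * x v) * share ω + y
  ... | no _        = y

  loopFactor-loop : ∀ {A ω v} y → Subtr A → ¬ Meets A ω → cls v ≡ ω → Loop A v →
                    loopFactor A ω y ≡ (t * x v) * share ω + y
  loopFactor-loop {A} {ω} {v} y stA ¬meets cls-v loop-v with classLoop? A ω
  ... | yes (v′ , cls-v′ , loop-v′) =
          cong (λ u → (t * x u) * share ω + y) (loop-unique stA ¬meets′ (trans cls-v′ (sym cls-v)) loop-v′ loop-v)
    where
    ¬meets′ : ¬ Meets A (cls v′)
    ¬meets′ = subst (λ ω′ → ¬ Meets A ω′) (sym cls-v′) ¬meets
  ... | no ¬loop = ⊥-elim (¬loop (v , cls-v , loop-v))

  loopFactor-noLoop : ∀ {A ω} y → (∀ v → cls v ≡ ω → ¬ Loop A v) → loopFactor A ω y ≡ y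
  loopFactor-noLoop {A} {ω} y ¬loop with classLoop? A ω
  ... | yes (v , cls-v , loop-v) = ⊥-elim (¬loop v cls-v loop-v)
  ... | no _ = refl

  loopFactor-cong : ∀ {A A′ ω} y → Subtr A′ → ¬ Meets A′ ω →
                    (∀ v → cls v ≡ ω → Loop A v → Loop A′ v) → (∀ v → cls v ≡ ω → Loop A′ v → Loop A v) →
                    loopFactor A ω y ≡ loopFactor A′ ω y
  loopFactor-cong {A} {A′} {ω} y stA′ ¬meets′ to from with classLoop? A ω
  ... | yes (v , cls-v , loop-v) = sym (loopFactor-loop y stA′ ¬meets′ cls-v (to v cls-v loop-v))
  ... | no ¬loop = sym (loopFactor-noLoop y (λ v cls-v loop-v → ¬loop (v , cls-v , from v cls-v loop-v)))

  share-others : NonDegenerate Z → ∀ {v ω} → cls v ≡ ω →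
                 share ω * sumFin (λ u → when (cls u ≟ᶠ ω ×-dec ¬? (u ≟ᶠ v)) 1ℚ) ≡ 1ℚ
  share-others nonDeg {v} {ω} cls-v = begin
    share ω * sumFin (λ u → when (other? u) 1ℚ)
      ≡⟨ cong₂ _*_ (cong (λ k → inv (k ∸ 1)) size≡1+others) (sym others≡) ⟩
    inv others * fromℕ others
      ≡⟨ inv-*-fromℕ others-pos ⟩
    1ℚ
      ∎
    where
    open ≡-Reasoning
    other? : ∀ u → Dec (cls u ≡ ω × ¬ u ≡ v)
    other? u = cls u ≟ᶠ ω ×-dec ¬? (u ≟ᶠ v)
    others : ℕ
    others = countFin (λ u → indicator (other? u))
    others≡ : fromℕ others ≡ sumFin (λ u → when (other? u) 1ℚ)
    others≡ = trans (fromℕ-countFin (λ u → indicator (other? u))) (sumFin-cong (λ u → fromℕ-indicator (other? u)))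
    size≡1+others : classSize cls ω ≡ suc others
    size≡1+others = begin
      classSize cls ω
        ≡⟨ classSize-countFin cls ω ⟩
      countFin (λ u → indicator (cls u ≟ᶠ ω))
        ≡⟨ countFin-cong (λ u → indicator-split (cls u ≟ᶠ ω) (u ≟ᶠ v) λ { refl → cls-v }) ⟩
      countFin (λ u → indicator (u ≟ᶠ v) ℕ.+ indicator (other? u))
        ≡⟨ countFin-+ (λ u → indicator (u ≟ᶠ v)) (λ u → indicator (other? u)) ⟩
      countFin (λ u → indicator (u ≟ᶠ v)) ℕ.+ others
        ≡⟨ cong (ℕ._+ others) (trans (countFin-single v (λ u u≢v → indicator-no (u ≟ᶠ v) u≢v))
                                     (indicator-yes (v ≟ᶠ v) refl)) ⟩
      suc others
        ∎
    others-pos : 1 ℕ.≤ others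
    others-pos with nonDeg ω
    ... | a , b , a≢b , cls-a , cls-b with a ≟ᶠ v
    ...   | yes refl = countFin-pos _ b
                           (ℕ.≤-reflexive (sym (indicator-yes (other? b) (cls-b , λ b≡a → a≢b (sym b≡a)))))
    ...   | no a≢v   = countFin-pos _ a (ℕ.≤-reflexive (sym (indicator-yes (other? a) (cls-a , a≢v))))

  -- for a basis W, ω is active exactly when it contains a loop over the part of W above ω
  activityFactor : Subset n → Fin m → ℚ
  activityFactor W ω = loopFactor (Above W ω) ω (xOfIn Z x t W ω)

  xOfIn-≡ : ∀ {S ω} w → Subtr S → w ∈ S → cls w ≡ ω → xOfIn Z x t S ω ≡ x w
  xOfIn-≡ {S} {ω} w stS w∈S cls-w with any? (λ u → (u ∈? S) ×-dec (cls u ≟ᶠ ω))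
  ... | yes (u , u∈S , cls-u) = cong x (stS u w u∈S w∈S (trans cls-u (sym cls-w)))
  ... | no ¬meets = ⊥-elim (¬meets (w , w∈S , cls-w))

  xOfDiff-≡ : ∀ {C B} v → v ∈ C → v ∉ B → (∀ u → u ∈ C → u ∉ B → u ≡ v) → xOfDiff Z x t C B ≡ x v
  xOfDiff-≡ {C} {B} v v∈C v∉B unique with any? (λ u → (u ∈? C) ×-dec ¬? (u ∈? B))
  ... | yes (u , u∈C , u∉B) = cong x (unique u u∈C u∉B)
  ... | no ¬diff = ⊥-elim (¬diff (v , v∈C , v∉B))

  module OnBasis {B} (trB : Transversal cls B) (indB : Independent Z B) (ω : Fin m) where
    B↑ : Subset n
    B↑ = Above B ω

    indB↑ : Independent Z B↑
    indB↑ = Independent-⊆ indB Above-⊆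

    ¬Meets-B↑ : ∀ {v} → cls v ≡ ω → ¬ Meets B↑ (cls v)
    ¬Meets-B↑ refl = ¬Meets-Above

    v∉B↑ : ∀ {v} → cls v ≡ ω → v ∉ B↑
    v∉B↑ cls-v v∈B↑ = ¬Meets-B↑ cls-v (_ , v∈B↑ , refl)

    Subtr-B↑∪ : ∀ {v} → cls v ≡ ω → Subtr (B↑ ∪ ⁅ v ⁆)
    Subtr-B↑∪ {v} cls-v = Subtr-∪⁅⁆ v (proj₁ indB↑) (¬Meets-B↑ cls-v)

    bω : Fin n
    bω = proj₁ (proj₂ trB ω)

    bω∈B : bω ∈ B
    bω∈B = proj₁ (proj₂ (proj₂ trB ω))

    cls-bω : cls bω ≡ ω
    cls-bω = proj₂ (proj₂ (proj₂ trB ω))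

    B′ : Subset n
    B′ = B - bω

    indB′ : Independent Z B′
    indB′ = Independent-⊆ indB (p─q⊆p B ⁅ bω ⁆)

    ¬Meets-B′ : ∀ {v} → cls v ≡ ω → ¬ Meets B′ (cls v)
    ¬Meets-B′ cls-v (u , u∈B′ , cls-u) = let u∈B , u∉bω = x∈p─q⁻ B ⁅ bω ⁆ u∈B′ in
      u∉bω (subst (_∈ ⁅ bω ⁆) (proj₁ indB bω u bω∈B u∈B (trans cls-bω (sym (trans cls-u cls-v)))) (x∈⁅x⁆ bω))

    B↑⊆B′ : B↑ ⊆ B′
    B↑⊆B′ {u} u∈B↑ = let u∈B , ω≺u = ∈-Above⁻ u∈B↑ in x∈p∧x≢y⇒x∈p-y u∈B λ { refl →
      ≺-irrefl′ (subst (ω ≺_) cls-bω ω≺u) }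

    noCircuit⇒noLoop : ¬ (∃ λ C → Circuit Z C × InBω Z B ω C) → ∀ v → cls v ≡ ω → ¬ Loop B↑ v
    noCircuit⇒noLoop ¬circuit v cls-v loop-v
      with circuit-⊆ (Subtr-B↑∪ cls-v)
                     (λ rank → Loop⇒¬Independent indB↑ (v∉B↑ cls-v) loop-v (Subtr-B↑∪ cls-v , rank))
    ... | C , circuit , C⊆B↑∪v = ¬circuit (C , circuit , λ u u∈C →
            [ (λ u∈B↑ → inj₁ (Above-⊆ u∈B↑)) , (λ u∈v → inj₂ (trans (cong cls (x∈⁅y⁆⇒x≡y v u∈v)) cls-v)) ]′
              (x∈p∪q⁻ B↑ ⁅ v ⁆ (C⊆B↑∪v u∈C)))

    module InCircuit {C} (circuit : Circuit Z C) (C⊆B∪ω : InBω Z B ω C) where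
      stC : Subtr C
      stC = proj₁ circuit

      -- a circuit is not contained in the independent set B
      outside-B : ∃ λ y → y ∈ C × cls y ≡ ω × y ∉ B
      outside-B with any? (λ y → (y ∈? C) ×-dec (cls y ≟ᶠ ω) ×-dec ¬? (y ∈? B))
      ... | yes found = found
      ... | no ¬found = ⊥-elim (Circuit⇒¬⊆Independent circuit indB λ {c} c∈C →
              [ (λ c∈B → c∈B) , (λ cls-c → decidable-stable (c ∈? B) λ c∉B → ¬found (c , c∈C , cls-c , c∉B)) ]′
                (C⊆B∪ω c c∈C))

      y : Fin n
      y = proj₁ outside-B

      y∈C : y ∈ C
      y∈C = proj₁ (proj₂ outside-B)

      cls-y : cls y ≡ ω
      cls-y = proj₁ (proj₂ (proj₂ outside-B))

      ≡y : ∀ {c} → c ∈ C → cls c ≡ ω → c ≡ y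
      ≡y c∈C cls-c = stC _ y c∈C y∈C (trans cls-c (sym cls-y))

      xOfDiff-y : xOfDiff Z x t C B ≡ x y
      xOfDiff-y = xOfDiff-≡ y y∈C (proj₂ (proj₂ (proj₂ outside-B))) λ u u∈C u∉B →
        ≡y u∈C ([ (λ u∈B → ⊥-elim (u∉B u∈B)) , (λ cls-u → cls-u) ]′ (C⊆B∪ω u u∈C))

      C⊆X∪y : ∀ {X} → (∀ {c} → c ∈ C → c ∈ B → cls c ≢ ω → c ∈ X) → C ⊆ X ∪ ⁅ y ⁆
      C⊆X∪y {X} B∖ω⊆X {c} c∈C with cls c ≟ᶠ ω | C⊆B∪ω c c∈C
      ... | yes cls-c  | _         = q⊆p∪q X ⁅ y ⁆ (subst (_∈ ⁅ y ⁆) (sym (≡y c∈C cls-c)) (x∈⁅x⁆ y))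
      ... | no cls-c≢ω | inj₂ cls-c = ⊥-elim (cls-c≢ω cls-c)
      ... | no cls-c≢ω | inj₁ c∈B  = p⊆p∪q ⁅ y ⁆ (B∖ω⊆X c∈C c∈B cls-c≢ω)

      C⊆B′∪y : C ⊆ B′ ∪ ⁅ y ⁆
      C⊆B′∪y = C⊆X∪y λ _ c∈B cls-c≢ω → x∈p∧x≢y⇒x∈p-y c∈B λ { refl → cls-c≢ω cls-bω }

      minIn⇒loop : MinIn Z x t _≺_ sto C ω → Loop B↑ y
      minIn⇒loop (_ , above) = decidable-stable (loop? B↑ y) λ ¬loop →
        Circuit⇒¬⊆Independent circuit (Independent-∪⁅⁆ indB↑ (¬Meets-B↑ cls-y) ¬loop)
          (C⊆X∪y λ c∈C c∈B cls-c≢ω → ∈-Above⁺ c∈B (above _ c∈C cls-c≢ω))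

      loop⇒minIn : ∀ {v} → cls v ≡ ω → Loop B↑ v → MinIn Z x t _≺_ sto C ω
      loop⇒minIn {v} cls-v loop-v = (y , y∈C , cls-y) , above
        where
        stB′∪v : Subtr (B′ ∪ ⁅ v ⁆)
        stB′∪v = Subtr-∪⁅⁆ v (proj₁ indB′) (¬Meets-B′ cls-v)

        -- otherwise B′ ∪ {y} would be an independent superset of C
        y≡v : y ≡ v
        y≡v = decidable-stable (y ≟ᶠ v) λ y≢v →
          Circuit⇒¬⊆Independent circuit (Independent-∪⁅⁆ indB′ (¬Meets-B′ cls-y) λ loop-y →
            y≢v (loop-unique (proj₁ indB′) (¬Meets-B′ cls-y) (trans cls-y (sym cls-v)) loop-y
                   (Loop-⊆ stB′∪v B↑⊆B′ loop-v)))
          C⊆B′∪y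

        C⊆B′∪v : C ⊆ B′ ∪ ⁅ v ⁆
        C⊆B′∪v = subst (λ u → C ⊆ B′ ∪ ⁅ u ⁆) y≡v C⊆B′∪y

        -- B′ ∪ {v} minus c would be independent, yet contains the dependent B↑ ∪ {v}
        ¬below : ∀ c → c ∈ C → ¬ cls c ≺ ω
        ¬below c c∈C c≺ω = Loop⇒¬Independent indB↑ (v∉B↑ cls-v) loop-v (Independent-⊆ indX-c B↑∪v⊆X-c)
          where
          X : Subset n
          X = B′ ∪ ⁅ v ⁆
          ∣X-c∣≡∣B′∣ : ∣ X - c ∣ ≡ ∣ B′ ∣
          ∣X-c∣≡∣B′∣ = ℕ.suc-injective (trans (sym (∣p∣≡1+∣p-x∣ (C⊆B′∪v c∈C)))
                         (∣p∪⁅x⁆∣≡1+∣p∣ B′ (λ v∈B′ → ¬Meets-B′ cls-v (v , v∈B′ , refl))))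
          indX-c : Independent Z (X - c)
          indX-c = stX-c , ℕ.≤-antisym (r-bounded stX-c) (begin
            ∣ X - c ∣   ≡⟨ trans ∣X-c∣≡∣B′∣ (sym (proj₂ indB′)) ⟩
            r B′        ≤⟨ r-monotone stB′∪v (p⊆p∪q ⁅ v ⁆) ⟩
            r X         ≤⟨ circuit-spans circuit stB′∪v C⊆B′∪v c∈C ⟩
            r (X - c)   ∎)
            where
            open ℕ.≤-Reasoning
            stX-c = Subtr-⊆ stB′∪v (p─q⊆p X ⁅ c ⁆)
          B↑∪v⊆X-c : B↑ ∪ ⁅ v ⁆ ⊆ X - c
          B↑∪v⊆X-c {u} u∈ with x∈p∪q⁻ B↑ ⁅ v ⁆ u∈
          ... | inj₁ u∈B↑ = x∈p∧x≢y⇒x∈p-y (p⊆p∪q ⁅ v ⁆ (B↑⊆B′ u∈B↑)) λ { refl →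
                  ≺-irrefl′ (≺-trans (proj₂ (∈-Above⁻ u∈B↑)) c≺ω) }
          ... | inj₂ u∈v = x∈p∧x≢y⇒x∈p-y (q⊆p∪q B′ ⁅ v ⁆ u∈v) λ { refl →
                  ≺-irrefl′ (subst (_≺ ω) (trans (cong cls (x∈⁅y⁆⇒x≡y v u∈v)) cls-v) c≺ω) }

        above : ∀ c → c ∈ C → cls c ≢ ω → ω ≺ cls c
        above c c∈C cls-c≢ω with compare ω (cls c)
        ... | tri< ω≺c _ _ = ω≺c
        ... | tri≈ _ ω≡c _ = ⊥-elim (cls-c≢ω (sym ω≡c))
        ... | tri> _ _ c≺ω = ⊥-elim (¬below c c∈C c≺ω)

    factor≡activityFactor : factor Z x t _≺_ sto B ω ≡ activityFactor B ω
    factor≡activityFactor with fundCirc? Z B ω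
    ... | no ¬circuit = sym (loopFactor-noLoop _ (noCircuit⇒noLoop ¬circuit))
    ... | yes (C , circuit , C⊆B∪ω) with minIn? Z x t _≺_ sto C ω
    ...   | yes minIn = trans (cong (λ z → (t * z) * share ω + _) xOfDiff-y)
                          (sym (loopFactor-loop _ (proj₁ indB↑) ¬Meets-Above cls-y (minIn⇒loop minIn)))
      where open InCircuit circuit C⊆B∪ω
    ...   | no ¬minIn = sym (loopFactor-noLoop _ λ v cls-v loop-v →
                          ¬minIn (InCircuit.loop⇒minIn circuit C⊆B∪ω cls-v loop-v))

module Expansion {n m : ℕ} (Z : Multimatroid n m) (nonDeg : NonDegenerate Z)
                 (_≺_ : Rel (Fin m) 0ℓ) (sto : IsStrictTotalOrder _≡_ _≺_) (x : Fin n → ℚ) (t : ℚ) where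
  open Multimatroid Z
  open MultimatroidProperties Z
  open Activity Z _≺_ sto x t
  open IsStrictTotalOrder sto using (compare) renaming (trans to ≺-trans)

  weight : Subset n → ℚ
  weight T = (t ^ℚ nullity Z T) * prodIn T x

  extensionSum : Subset n → ℚ
  extensionSum P = sumSub (λ T → when (transversal? cls T ×-dec (P ⊆? T)) (weight T))

  Apart : Subset n → Subset n → Set
  Apart P S = ∀ w → w ∈ S → ¬ Meets P (cls w)

  Covers : Subset n → Subset n → Set
  Covers P S = ∀ ω → ¬ Meets P ω → Meets S ω

  -- S is a basis of the contraction Z / P: it completes P to a transversal and is independent over P
  ContractionBasis : Subset n → Subset n → Set
  ContractionBasis P S = Apart P S × Subtr S × Covers P S × r (S ∪ P) ≡ r P ℕ.+ ∣ S ∣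

  contractionBasis? : ∀ P S → Dec (ContractionBasis P S)
  contractionBasis? P S = all? (λ u → (u ∈? S) →-dec ¬? (meets? P (cls u))) ×-dec subtransversal? cls S ×-dec
                          all? (λ ω → ¬? (meets? P ω) →-dec meets? S ω) ×-dec (r (S ∪ P) ℕ.≟ r P ℕ.+ ∣ S ∣)

  relFactor : Subset n → Subset n → Fin m → ℚ
  relFactor P S ω = if does (meets? P ω) then 1ℚ else activityFactor (S ∪ P) ω

  basisTerm : Subset n → Subset n → ℚ
  basisTerm P S = when (contractionBasis? P S) (prodFin (relFactor P S))

  contractionSum : Subset n → ℚ
  contractionSum P = sumSub (basisTerm P)

  UpperClosed : Subset n → Set
  UpperClosed P = ∀ {u ω} → u ∈ P → cls u ≺ ω → Meets P ω

  ExpansionAt : Subset n → Set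
  ExpansionAt P = extensionSum P ≡ weight P * contractionSum P

  expansion-transversal : ∀ {P} → Transversal cls P → ExpansionAt P
  expansion-transversal {P} trP@(stP , covers) = begin
    extensionSum P
      ≡⟨ sumSub-single P (λ T T≢P → when-no (transversal? cls T ×-dec (P ⊆? T))
                                      λ (trT , P⊆T) → T≢P (⊆-antisym (T⊆P trT P⊆T) P⊆T)) ⟩
    when (transversal? cls P ×-dec (P ⊆? P)) (weight P)
      ≡⟨ when-yes (transversal? cls P ×-dec (P ⊆? P)) (trP , λ u∈ → u∈) ⟩
    weight P
      ≡⟨ ℚ.*-identityʳ (weight P) ⟨
    weight P * 1ℚ
      ≡⟨ cong (weight P *_) contractionSum≡1 ⟨
    weight P * contractionSum P
      ∎
    where
    open ≡-Reasoning
    T⊆P : ∀ {T} → Transversal cls T → P ⊆ T → T ⊆ P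
    T⊆P (stT , _) P⊆T {w} w∈T with covers (cls w)
    ... | p , p∈P , cls-p = subst (_∈ P) (stT p w (P⊆T p∈P) w∈T cls-p) p∈P
    ⊥-basis : ContractionBasis P ⊥
    ⊥-basis = (λ u u∈⊥ → ⊥-elim (∉⊥ u∈⊥)) , Subtr-⊥ , (λ ω ¬meets → ⊥-elim (¬meets (covers ω))) ,
              trans (cong r (∪-identityˡ P)) (trans (sym (ℕ.+-identityʳ (r P))) (cong (r P ℕ.+_) (sym (∣⊥∣≡0 n))))
    only-⊥ : ∀ S → S ≢ ⊥ → ¬ ContractionBasis P S
    only-⊥ S S≢⊥ (apart , _) =
      S≢⊥ (⊆-antisym (λ {w} w∈S → ⊥-elim (apart w w∈S (covers (cls w)))) λ w∈⊥ → ⊥-elim (∉⊥ w∈⊥))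
    contractionSum≡1 : contractionSum P ≡ 1ℚ
    contractionSum≡1 = trans (sumSub-single ⊥ (λ S S≢⊥ → when-no (contractionBasis? P S) (only-⊥ S S≢⊥)))
      (trans (when-yes (contractionBasis? P ⊥) ⊥-basis) (prodFin-one (λ ω → if-yes (meets? P ω) (covers ω))))

  module Step {P} (stP : Subtr P) (upP : UpperClosed P) {ω₀} (¬meets₀ : ¬ Meets P ω₀)
              (maximal : ∀ {ω} → ¬ Meets P ω → ω ≺ ω₀ ⊎ ω ≡ ω₀) where

    ¬Meets-cls : ∀ {u} → cls u ≡ ω₀ → ¬ Meets P (cls u)
    ¬Meets-cls refl = ¬meets₀

    ∉P : ∀ {u} → cls u ≡ ω₀ → u ∉ P
    ∉P cls-u u∈P = ¬Meets-cls cls-u (_ , u∈P , refl)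

    Subtr-P∪ : ∀ {u} → cls u ≡ ω₀ → Subtr (P ∪ ⁅ u ⁆)
    Subtr-P∪ {u} cls-u = Subtr-∪⁅⁆ u stP (¬Meets-cls cls-u)

    Meets-P∪⁻ : ∀ {u ω} → cls u ≡ ω₀ → Meets (P ∪ ⁅ u ⁆) ω → Meets P ω ⊎ ω ≡ ω₀
    Meets-P∪⁻ cls-u meets = Sum.map₂ (λ cls-u≡ω → trans (sym cls-u≡ω) cls-u) (Meets-∪⁅⁆⁻ meets)

    Meets-P∪-swap : ∀ {u v ω} → cls u ≡ ω₀ → cls v ≡ ω₀ → Meets (P ∪ ⁅ u ⁆) ω → Meets (P ∪ ⁅ v ⁆) ω
    Meets-P∪-swap {u} {v} cls-u cls-v meets with Meets-P∪⁻ cls-u meets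
    ... | inj₁ meets-P = Meets-mono (p⊆p∪q ⁅ v ⁆) meets-P
    ... | inj₂ refl    = subst (Meets (P ∪ ⁅ v ⁆)) cls-v (Meets-∪⁅⁆ P v)

    unmet-below : ∀ {ω} → ¬ Meets P ω → ω ≢ ω₀ → ω ≺ ω₀
    unmet-below ¬meets ω≢ω₀ = [ (λ ω≺ω₀ → ω≺ω₀) , (λ ω≡ω₀ → ⊥-elim (ω≢ω₀ ω≡ω₀)) ]′ (maximal ¬meets)

    ¬above-ω₀ : ∀ {ω} → ¬ Meets P ω → ¬ ω₀ ≺ ω
    ¬above-ω₀ ¬meets ω₀≺ω =
      [ (λ ω≺ω₀ → ≺-irrefl′ (≺-trans ω≺ω₀ ω₀≺ω)) , (λ { refl → ≺-irrefl′ ω₀≺ω }) ]′ (maximal ¬meets)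

    met-above : ∀ {w ω} → w ∈ P → ¬ Meets P ω → ω ≺ cls w
    met-above {w} {ω} w∈P ¬meets with compare ω (cls w)
    ... | tri< ω≺w _ _ = ω≺w
    ... | tri≈ _ ω≡w _ = ⊥-elim (¬meets (w , w∈P , sym ω≡w))
    ... | tri> _ _ w≺ω = ⊥-elim (¬meets (upP w∈P w≺ω))

    UpperClosed-P∪ : ∀ {u} → cls u ≡ ω₀ → UpperClosed (P ∪ ⁅ u ⁆)
    UpperClosed-P∪ {u} cls-u {w} {ω} w∈ w≺ω with x∈p∪q⁻ P ⁅ u ⁆ w∈
    ... | inj₁ w∈P = Meets-mono (p⊆p∪q ⁅ u ⁆) (upP w∈P w≺ω)
    ... | inj₂ w∈u = Meets-mono (p⊆p∪q ⁅ u ⁆) (decidable-stable (meets? P ω) λ ¬meets →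
            ¬above-ω₀ ¬meets (subst (_≺ ω) (trans (cong cls (x∈⁅y⁆⇒x≡y u w∈u)) cls-u) w≺ω))

    inClass? : ∀ u → Dec (cls u ≡ ω₀)
    inClass? u = cls u ≟ᶠ ω₀

    extends? : ∀ Q T → Dec (Transversal cls T × Q ⊆ T)
    extends? Q T = transversal? cls T ×-dec (Q ⊆? T)

    extensionSum-split : extensionSum P ≡ sumFin (λ u → when (inClass? u) (extensionSum (P ∪ ⁅ u ⁆)))
    extensionSum-split = begin
      extensionSum P
        ≡⟨ sumSub-cong split ⟩
      sumSub (λ T → sumFin (λ u → when (inClass? u) (when (extends? (P ∪ ⁅ u ⁆) T) (weight T))))
        ≡⟨ sumFin-sumSub (λ u T → when (inClass? u) (when (extends? (P ∪ ⁅ u ⁆) T) (weight T))) ⟨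
      sumFin (λ u → sumSub (λ T → when (inClass? u) (when (extends? (P ∪ ⁅ u ⁆) T) (weight T))))
        ≡⟨ sumFin-cong (λ u → when-sumSub (inClass? u) (λ T → when (extends? (P ∪ ⁅ u ⁆) T) (weight T))) ⟨
      sumFin (λ u → when (inClass? u) (extensionSum (P ∪ ⁅ u ⁆)))
        ∎
      where
      open ≡-Reasoning
      -- a transversal T ⊇ P contains exactly one element of ω₀
      split : ∀ T → when (extends? P T) (weight T) ≡
                    sumFin (λ u → when (inClass? u) (when (extends? (P ∪ ⁅ u ⁆) T) (weight T)))
      split T with extends? P T
      ... | no ¬ext = trans (when-no (extends? P T) ¬ext) (sym (sumFin-zero λ u →
              when-when-disjoint (inClass? u) (extends? (P ∪ ⁅ u ⁆) T)
                λ (_ , trT , P∪u⊆T) → ¬ext (trT , λ w∈P → P∪u⊆T (p⊆p∪q ⁅ u ⁆ w∈P))))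
      ... | yes ext@(trT@(stT , coversT) , P⊆T) with coversT ω₀
      ...   | u₀ , u₀∈T , cls-u₀ = begin
        when (extends? P T) (weight T)
          ≡⟨ when-yes (extends? P T) ext ⟩
        weight T
          ≡⟨ sumFin-when-unique (λ u → inClass? u ×-dec extends? (P ∪ ⁅ u ⁆) T) u₀ (cls-u₀ , trT , P∪u₀⊆T) unique ⟨
        sumFin (λ u → when (inClass? u ×-dec extends? (P ∪ ⁅ u ⁆) T) (weight T))
          ≡⟨ sumFin-cong (λ u → when-when (inClass? u) (extends? (P ∪ ⁅ u ⁆) T)) ⟨
        sumFin (λ u → when (inClass? u) (when (extends? (P ∪ ⁅ u ⁆) T) (weight T)))
          ∎
        where
        P∪u₀⊆T : P ∪ ⁅ u₀ ⁆ ⊆ T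
        P∪u₀⊆T w∈ = [ P⊆T , (λ w∈u₀ → subst (_∈ T) (sym (x∈⁅y⁆⇒x≡y u₀ w∈u₀)) u₀∈T) ]′ (x∈p∪q⁻ P ⁅ u₀ ⁆ w∈)
        unique : ∀ {u} → cls u ≡ ω₀ × Transversal cls T × P ∪ ⁅ u ⁆ ⊆ T → u ≡ u₀
        unique {u} (cls-u , _ , P∪u⊆T) = stT u u₀ (P∪u⊆T (q⊆p∪q P ⁅ u ⁆ (x∈⁅x⁆ u))) u₀∈T (trans cls-u (sym cls-u₀))

    ∪-swap : ∀ S u → (S ∪ ⁅ u ⁆) ∪ P ≡ S ∪ (P ∪ ⁅ u ⁆)
    ∪-swap S u = trans (∪-assoc S ⁅ u ⁆ P) (cong (S ∪_) (∪-comm ⁅ u ⁆ P))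

    Subtr-∪P : ∀ {S} → Subtr S → Apart P S → Subtr (S ∪ P)
    Subtr-∪P stS apart = Subtr-∪ stS stP (λ {a} {b} a∈S b∈P cls-ab → apart a a∈S (b , b∈P , sym cls-ab))

    Apart-P : ∀ {u S} → Apart (P ∪ ⁅ u ⁆) S → Apart P S
    Apart-P {u} apart w w∈S meets = apart w w∈S (Meets-mono (p⊆p∪q ⁅ u ⁆) meets)

    Apart-swap : ∀ {a b S} → cls a ≡ ω₀ → cls b ≡ ω₀ → Apart (P ∪ ⁅ a ⁆) S → Apart (P ∪ ⁅ b ⁆) S
    Apart-swap cls-a cls-b apart w w∈S meets = apart w w∈S (Meets-P∪-swap cls-b cls-a meets)

    Covers-swap : ∀ {a b S} → cls a ≡ ω₀ → cls b ≡ ω₀ → Covers (P ∪ ⁅ a ⁆) S → Covers (P ∪ ⁅ b ⁆) S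
    Covers-swap cls-a cls-b covers ω ¬meets = covers ω (λ meets → ¬meets (Meets-P∪-swap cls-a cls-b meets))

    ¬Meets-∪P : ∀ {u S} → cls u ≡ ω₀ → Apart (P ∪ ⁅ u ⁆) S → ¬ Meets (S ∪ P) ω₀
    ¬Meets-∪P {u} {S} cls-u apart (w , w∈ , cls-w) with x∈p∪q⁻ S P w∈
    ... | inj₁ w∈S = apart w w∈S (subst (Meets (P ∪ ⁅ u ⁆)) (trans cls-u (sym cls-w)) (Meets-∪⁅⁆ P u))
    ... | inj₂ w∈P = ¬meets₀ (w , w∈P , cls-w)

    basis-∪⁅⁆⁻ : ∀ {u S} → cls u ≡ ω₀ → u ∉ S → ContractionBasis P (S ∪ ⁅ u ⁆) →
                 ¬ Loop P u × ContractionBasis (P ∪ ⁅ u ⁆) S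
    basis-∪⁅⁆⁻ {u} {S} cls-u u∉S (apart , stS∪u , covers , rank) =
      (λ loop → ℕ.1+n≢n (trans (sym rank-P∪u) loop)) , apart′ , Subtr-⊆ stS∪u (p⊆p∪q ⁅ u ⁆) , covers′ ,
      trans rank-S∪P∪u (trans (ℕ.+-suc (r P) ∣ S ∣) (cong (ℕ._+ ∣ S ∣) (sym rank-P∪u)))
      where
      rank-S∪P∪u : r (S ∪ (P ∪ ⁅ u ⁆)) ≡ r P ℕ.+ suc ∣ S ∣
      rank-S∪P∪u = trans (cong r (sym (∪-swap S u))) (trans rank (cong (r P ℕ.+_) (∣p∪⁅x⁆∣≡1+∣p∣ S u∉S)))
      stS∪P∪u : Subtr ((P ∪ ⁅ u ⁆) ∪ S)
      stS∪P∪u = subst Subtr (trans (∪-swap S u) (∪-comm S _)) (Subtr-∪P stS∪u apart)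
      rank-P∪u : r (P ∪ ⁅ u ⁆) ≡ suc (r P)
      rank-P∪u = ℕ.≤-antisym (r-∪⁅⁆-≤ u (Subtr-P∪ cls-u)) (ℕ.+-cancelʳ-≤ ∣ S ∣ _ _ (begin
        suc (r P) ℕ.+ ∣ S ∣          ≡⟨ trans rank-S∪P∪u (ℕ.+-suc (r P) ∣ S ∣) ⟨
        r (S ∪ (P ∪ ⁅ u ⁆))          ≡⟨ cong r (∪-comm S _) ⟩
        r ((P ∪ ⁅ u ⁆) ∪ S)          ≤⟨ r-∪-≤ stS∪P∪u ⟩
        r (P ∪ ⁅ u ⁆) ℕ.+ ∣ S ∣      ∎))
        where open ℕ.≤-Reasoning
      apart′ : Apart (P ∪ ⁅ u ⁆) S
      apart′ w w∈S meets with Meets-P∪⁻ cls-u meets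
      ... | inj₁ meets-P = apart w (p⊆p∪q ⁅ u ⁆ w∈S) meets-P
      ... | inj₂ cls-w   = u∉S (subst (_∈ S) (stS∪u w u (p⊆p∪q ⁅ u ⁆ w∈S) (q⊆p∪q S ⁅ u ⁆ (x∈⁅x⁆ u))
                                                  (trans cls-w (sym cls-u))) w∈S)
      covers′ : Covers (P ∪ ⁅ u ⁆) S
      covers′ ω ¬meets with covers ω (λ meets-P → ¬meets (Meets-mono (p⊆p∪q ⁅ u ⁆) meets-P))
      ... | w , w∈ , cls-w with Meets-∪⁅⁆⁻ (w , w∈ , cls-w)
      ...   | inj₁ meets-S = meets-S
      ...   | inj₂ cls-u≡ω = ⊥-elim (¬meets (subst (Meets (P ∪ ⁅ u ⁆)) cls-u≡ω (Meets-∪⁅⁆ P u)))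

    basis-∪⁅⁆⁺ : ∀ {u S} → cls u ≡ ω₀ → ¬ Loop P u → ContractionBasis (P ∪ ⁅ u ⁆) S →
                 ContractionBasis P (S ∪ ⁅ u ⁆)
    basis-∪⁅⁆⁺ {u} {S} cls-u ¬loop (apart , stS , covers , rank) =
      apart′ , Subtr-∪⁅⁆ u stS ¬meets-S , covers′ , (begin
      r ((S ∪ ⁅ u ⁆) ∪ P)          ≡⟨ cong r (∪-swap S u) ⟩
      r (S ∪ (P ∪ ⁅ u ⁆))          ≡⟨ rank ⟩
      r (P ∪ ⁅ u ⁆) ℕ.+ ∣ S ∣      ≡⟨ cong (ℕ._+ ∣ S ∣) (nonloop-rank stP (¬Meets-cls cls-u) ¬loop) ⟩
      suc (r P) ℕ.+ ∣ S ∣          ≡⟨ ℕ.+-suc (r P) ∣ S ∣ ⟨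
      r P ℕ.+ suc ∣ S ∣            ≡⟨ cong (r P ℕ.+_) (∣p∪⁅x⁆∣≡1+∣p∣ S (λ u∈S → ¬meets-S (u , u∈S , refl))) ⟨
      r P ℕ.+ ∣ S ∪ ⁅ u ⁆ ∣        ∎)
      where
      open ≡-Reasoning
      ¬meets-S : ¬ Meets S (cls u)
      ¬meets-S (w , w∈S , cls-w) = apart w w∈S (subst (Meets (P ∪ ⁅ u ⁆)) (sym cls-w) (Meets-∪⁅⁆ P u))
      apart′ : Apart P (S ∪ ⁅ u ⁆)
      apart′ w w∈ with x∈p∪q⁻ S ⁅ u ⁆ w∈
      ... | inj₁ w∈S = λ meets-P → apart w w∈S (Meets-mono (p⊆p∪q ⁅ u ⁆) meets-P)
      ... | inj₂ w∈u = subst (λ w′ → ¬ Meets P (cls w′)) (sym (x∈⁅y⁆⇒x≡y u w∈u)) (¬Meets-cls cls-u)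
      covers′ : Covers P (S ∪ ⁅ u ⁆)
      covers′ ω ¬meets with ω ≟ᶠ ω₀
      ... | yes refl = subst (Meets (S ∪ ⁅ u ⁆)) cls-u (Meets-∪⁅⁆ S u)
      ... | no ω≢ω₀ = Meets-mono (p⊆p∪q ⁅ u ⁆) (covers ω λ meets → [ ¬meets , ω≢ω₀ ]′ (Meets-P∪⁻ cls-u meets))

    ownFactor : Fin n → ℚ
    ownFactor u = loopFactor P ω₀ (x u)

    relFactor-∪⁅⁆ : ∀ {u S} → cls u ≡ ω₀ → ContractionBasis P (S ∪ ⁅ u ⁆) →
                    prodFin (relFactor P (S ∪ ⁅ u ⁆)) ≡ ownFactor u * prodFin (relFactor (P ∪ ⁅ u ⁆) S)
    relFactor-∪⁅⁆ {u} {S} cls-u (apart , stS∪u , _) =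
      trans (prodFin-extract ω₀ (if-yes (meets? (P ∪ ⁅ u ⁆) ω₀) (subst (Meets _) cls-u (Meets-∪⁅⁆ P u))) others)
            (cong (_* prodFin (relFactor (P ∪ ⁅ u ⁆) S)) at-ω₀)
      where
      W : Subset n
      W = (S ∪ ⁅ u ⁆) ∪ P
      others : ∀ ω → ω ≢ ω₀ → relFactor P (S ∪ ⁅ u ⁆) ω ≡ relFactor (P ∪ ⁅ u ⁆) S ω
      others ω ω≢ω₀ = trans (cong (λ W′ → if does (meets? P ω) then 1ℚ else activityFactor W′ ω) (∪-swap S u))
        (if-⇔ (meets? P ω) (meets? (P ∪ ⁅ u ⁆) ω) (Meets-mono (p⊆p∪q ⁅ u ⁆))
              (λ meets → [ (λ meets-P → meets-P) , (λ ω≡ω₀ → ⊥-elim (ω≢ω₀ ω≡ω₀)) ]′ (Meets-P∪⁻ cls-u meets)))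
      -- S only meets classes not above ω₀, while P lies entirely above ω₀
      Above-W≡P : Above W ω₀ ≡ P
      Above-W≡P = ⊆-antisym Above⊆P (λ w∈P → ∈-Above⁺ (q⊆p∪q (S ∪ ⁅ u ⁆) P w∈P) (met-above w∈P ¬meets₀))
        where
        Above⊆P : Above W ω₀ ⊆ P
        Above⊆P {w} w∈ with ∈-Above⁻ w∈
        ... | w∈W , ω₀≺w = [ (λ w∈S∪u → ⊥-elim (¬above-ω₀ (apart w w∈S∪u) ω₀≺w)) , (λ w∈P → w∈P) ]′
                             (x∈p∪q⁻ (S ∪ ⁅ u ⁆) P w∈W)
      at-ω₀ : relFactor P (S ∪ ⁅ u ⁆) ω₀ ≡ ownFactor u
      at-ω₀ = trans (if-no (meets? P ω₀) ¬meets₀)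
        (cong₂ (λ A y → loopFactor A ω₀ y) Above-W≡P
               (xOfIn-≡ u (Subtr-∪P stS∪u apart) (p⊆p∪q P (q⊆p∪q S ⁅ u ⁆ (x∈⁅x⁆ u))) cls-u))

    basisTerm-∪⁅⁆ : ∀ {u} → cls u ≡ ω₀ → ∀ S →
                    when (¬? (u ∈? S)) (basisTerm P (S ∪ ⁅ u ⁆)) ≡
                    when (¬? (loop? P u)) (ownFactor u * basisTerm (P ∪ ⁅ u ⁆) S)
    basisTerm-∪⁅⁆ {u} cls-u S with u ∈? S
    ... | yes u∈S = sym (begin
            when (¬? (loop? P u)) (ownFactor u * basisTerm (P ∪ ⁅ u ⁆) S)
              ≡⟨ cong (λ z → when (¬? (loop? P u)) (ownFactor u * z)) (when-no (contractionBasis? (P ∪ ⁅ u ⁆) S)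
                   λ (apart , _) → apart u u∈S (Meets-∪⁅⁆ P u)) ⟩
            when (¬? (loop? P u)) (ownFactor u * 0ℚ)
              ≡⟨ cong (when (¬? (loop? P u))) (ℚ.*-zeroʳ (ownFactor u)) ⟩
            when (¬? (loop? P u)) 0ℚ
              ≡⟨ when-zero (¬? (loop? P u)) ⟩
            0ℚ
              ∎)
      where open ≡-Reasoning
    ... | no u∉S with contractionBasis? P (S ∪ ⁅ u ⁆)
    ...   | yes basis = let ¬loop , basis′ = basis-∪⁅⁆⁻ cls-u u∉S basis in begin
            basisTerm P (S ∪ ⁅ u ⁆)
              ≡⟨ when-yes (contractionBasis? P (S ∪ ⁅ u ⁆)) basis ⟩
            prodFin (relFactor P (S ∪ ⁅ u ⁆))
              ≡⟨ relFactor-∪⁅⁆ cls-u basis ⟩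
            ownFactor u * prodFin (relFactor (P ∪ ⁅ u ⁆) S)
              ≡⟨ cong (ownFactor u *_) (when-yes (contractionBasis? (P ∪ ⁅ u ⁆) S) basis′) ⟨
            ownFactor u * basisTerm (P ∪ ⁅ u ⁆) S
              ≡⟨ when-yes (¬? (loop? P u)) ¬loop ⟨
            when (¬? (loop? P u)) (ownFactor u * basisTerm (P ∪ ⁅ u ⁆) S)
              ∎
      where open ≡-Reasoning
    ...   | no ¬basis = trans (when-no (contractionBasis? P (S ∪ ⁅ u ⁆)) ¬basis) (sym (no-term (loop? P u)))
      where
      no-term : (d : Dec (Loop P u)) → when (¬? d) (ownFactor u * basisTerm (P ∪ ⁅ u ⁆) S) ≡ 0ℚ
      no-term (yes _)    = refl
      no-term (no ¬loop) = trans (cong (ownFactor u *_) (when-no (contractionBasis? (P ∪ ⁅ u ⁆) S)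
                                    λ basis′ → ¬basis (basis-∪⁅⁆⁺ cls-u ¬loop basis′)))
                                 (ℚ.*-zeroʳ (ownFactor u))

    basisTerm-split : ∀ S → basisTerm P S ≡ sumFin (λ u → when (inClass? u) (when (u ∈? S) (basisTerm P S)))
    basisTerm-split S with contractionBasis? P S
    ... | no ¬basis = trans term≡0 (sym (sumFin-zero λ u →
            trans (cong (λ q → when (inClass? u) (when (u ∈? S) q)) term≡0)
                  (trans (cong (when (inClass? u)) (when-zero (u ∈? S))) (when-zero (inClass? u)))))
      where
      term≡0 : basisTerm P S ≡ 0ℚ
      term≡0 = when-no (contractionBasis? P S) ¬basis
    ... | yes (_ , stS , covers , _) with covers ω₀ ¬meets₀
    ...   | u₀ , u₀∈S , cls-u₀ = sym (trans (sumFin-cong (λ u → when-when (inClass? u) (u ∈? S)))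
              (sumFin-when-unique (λ u → inClass? u ×-dec (u ∈? S)) u₀ (cls-u₀ , u₀∈S)
                 λ (cls-u , u∈S) → stS _ u₀ u∈S u₀∈S (trans cls-u (sym cls-u₀))))

    contractionSum-containing : ∀ {u} → cls u ≡ ω₀ →
      sumSub (λ S → when (u ∈? S) (basisTerm P S)) ≡ when (¬? (loop? P u)) (ownFactor u * contractionSum (P ∪ ⁅ u ⁆))
    contractionSum-containing {u} cls-u = begin
      sumSub (λ S → when (u ∈? S) (basisTerm P S))
        ≡⟨ sumSub-insert u (basisTerm P) ⟩
      sumSub (λ S → when (¬? (u ∈? S)) (basisTerm P (S ∪ ⁅ u ⁆)))
        ≡⟨ sumSub-cong (basisTerm-∪⁅⁆ cls-u) ⟩
      sumSub (λ S → when (¬? (loop? P u)) (ownFactor u * basisTerm (P ∪ ⁅ u ⁆) S))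
        ≡⟨ when-sumSub (¬? (loop? P u)) (λ S → ownFactor u * basisTerm (P ∪ ⁅ u ⁆) S) ⟨
      when (¬? (loop? P u)) (sumSub (λ S → ownFactor u * basisTerm (P ∪ ⁅ u ⁆) S))
        ≡⟨ cong (when (¬? (loop? P u))) (sumSub-*ˡ (ownFactor u) (basisTerm (P ∪ ⁅ u ⁆))) ⟩
      when (¬? (loop? P u)) (ownFactor u * contractionSum (P ∪ ⁅ u ⁆))
        ∎
      where open ≡-Reasoning

    contractionSum-split : contractionSum P ≡
      sumFin (λ u → when (inClass? u) (when (¬? (loop? P u)) (ownFactor u * contractionSum (P ∪ ⁅ u ⁆))))
    contractionSum-split = begin
      sumSub (basisTerm P)
        ≡⟨ sumSub-cong basisTerm-split ⟩
      sumSub (λ S → sumFin (λ u → when (inClass? u) (when (u ∈? S) (basisTerm P S))))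
        ≡⟨ sumFin-sumSub (λ u S → when (inClass? u) (when (u ∈? S) (basisTerm P S))) ⟨
      sumFin (λ u → sumSub (λ S → when (inClass? u) (when (u ∈? S) (basisTerm P S))))
        ≡⟨ sumFin-cong (λ u → when-sumSub (inClass? u) (λ S → when (u ∈? S) (basisTerm P S))) ⟨
      sumFin (λ u → when (inClass? u) (sumSub (λ S → when (u ∈? S) (basisTerm P S))))
        ≡⟨ sumFin-cong (λ u → when-cong (inClass? u) contractionSum-containing) ⟩
      sumFin (λ u → when (inClass? u) (when (¬? (loop? P u)) (ownFactor u * contractionSum (P ∪ ⁅ u ⁆))))
        ∎
      where open ≡-Reasoning

    weight-nonloop : ∀ {u} → cls u ≡ ω₀ → ¬ Loop P u → weight (P ∪ ⁅ u ⁆) ≡ weight P * x u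
    weight-nonloop {u} cls-u ¬loop = begin
      (t ^ℚ nullity Z (P ∪ ⁅ u ⁆)) * prodIn (P ∪ ⁅ u ⁆) x
        ≡⟨ cong₂ (λ k y → (t ^ℚ k) * y)
                 (cong₂ _∸_ (∣p∪⁅x⁆∣≡1+∣p∣ P (∉P cls-u)) (nonloop-rank stP (¬Meets-cls cls-u) ¬loop))
                                         (prodIn-∪⁅⁆ P x (∉P cls-u)) ⟩
      (t ^ℚ nullity Z P) * (prodIn P x * x u)
        ≡⟨ ℚ.*-assoc (t ^ℚ nullity Z P) (prodIn P x) (x u) ⟨
      weight P * x u
        ∎
      where open ≡-Reasoning

    weight-loop : ∀ {v} → cls v ≡ ω₀ → Loop P v → weight (P ∪ ⁅ v ⁆) ≡ t * (weight P * x v)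
    weight-loop {v} cls-v loop = begin
      (t ^ℚ nullity Z (P ∪ ⁅ v ⁆)) * prodIn (P ∪ ⁅ v ⁆) x
        ≡⟨ cong₂ (λ k y → (t ^ℚ k) * y)
                 (trans (cong₂ _∸_ (∣p∪⁅x⁆∣≡1+∣p∣ P (∉P cls-v)) loop) (ℕ.+-∸-assoc 1 (r-bounded stP)))
                 (prodIn-∪⁅⁆ P x (∉P cls-v)) ⟩
      (t * (t ^ℚ nullity Z P)) * (prodIn P x * x v)
        ≡⟨ solve 4 (λ t tⁿ xP xv → (t :* tⁿ) :* (xP :* xv) := t :* ((tⁿ :* xP) :* xv)) refl t _ _ _ ⟩
      t * (weight P * x v)
        ∎
      where open ≡-Reasoning

    expansion-noLoop : (∀ u → cls u ≡ ω₀ → ¬ Loop P u) → (∀ u → cls u ≡ ω₀ → ExpansionAt (P ∪ ⁅ u ⁆)) →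
                       ExpansionAt P
    expansion-noLoop ¬loop expansion-P∪ = begin
      extensionSum P
        ≡⟨ extensionSum-split ⟩
      sumFin (λ u → when (inClass? u) (extensionSum (P ∪ ⁅ u ⁆)))
        ≡⟨ sumFin-cong (λ u → when-cong (inClass? u) extension) ⟩
      sumFin (λ u → when (inClass? u) (weight P * (x u * contractionSum (P ∪ ⁅ u ⁆))))
        ≡⟨ sumFin-when-*ˡ inClass? (weight P) (λ u → x u * contractionSum (P ∪ ⁅ u ⁆)) ⟩
      weight P * sumFin (λ u → when (inClass? u) (x u * contractionSum (P ∪ ⁅ u ⁆)))
        ≡⟨ cong (weight P *_) (sumFin-cong (λ u → when-cong (inClass? u) nonloop-factor)) ⟨
      weight P * sumFin (λ u → when (inClass? u) (when (¬? (loop? P u)) (ownFactor u * contractionSum (P ∪ ⁅ u ⁆))))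
        ≡⟨ cong (weight P *_) contractionSum-split ⟨
      weight P * contractionSum P
        ∎
      where
      open ≡-Reasoning
      extension : ∀ {u} → cls u ≡ ω₀ → extensionSum (P ∪ ⁅ u ⁆) ≡ weight P * (x u * contractionSum (P ∪ ⁅ u ⁆))
      extension {u} cls-u = trans (expansion-P∪ u cls-u)
        (trans (cong (_* contractionSum (P ∪ ⁅ u ⁆)) (weight-nonloop cls-u (¬loop u cls-u)))
               (ℚ.*-assoc (weight P) (x u) (contractionSum (P ∪ ⁅ u ⁆))))
      nonloop-factor : ∀ {u} → cls u ≡ ω₀ →
               when (¬? (loop? P u)) (ownFactor u * contractionSum (P ∪ ⁅ u ⁆)) ≡ x u * contractionSum (P ∪ ⁅ u ⁆)
      nonloop-factor {u} cls-u = trans (when-yes (¬? (loop? P u)) (¬loop u cls-u))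
        (cong (_* contractionSum (P ∪ ⁅ u ⁆)) (loopFactor-noLoop (x u) ¬loop))

    module WithLoop {v} (cls-v : cls v ≡ ω₀) (loop-v : Loop P v) where

      rank-shift : ∀ {X u} → Subtr X → ¬ Meets X ω₀ → P ⊆ X → cls u ≡ ω₀ → u ≢ v →
                   r (X ∪ ⁅ u ⁆) ≡ suc (r (X ∪ ⁅ v ⁆))
      rank-shift {X} stX ¬meets P⊆X cls-u u≢v =
        loop-shift stX (subst (λ ω → ¬ Meets X ω) (sym cls-v) ¬meets) P⊆X loop-v (trans cls-u (sym cls-v)) u≢v

      module Shift {u} (cls-u : cls u ≡ ω₀) (u≢v : u ≢ v) where

        rank-shift-P : r (P ∪ ⁅ u ⁆) ≡ suc (r (P ∪ ⁅ v ⁆))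
        rank-shift-P = rank-shift stP ¬meets₀ (λ w∈P → w∈P) cls-u u≢v

        rank-shift-S : ∀ {S} → Subtr S → Apart (P ∪ ⁅ u ⁆) S → r (S ∪ (P ∪ ⁅ u ⁆)) ≡ suc (r (S ∪ (P ∪ ⁅ v ⁆)))
        rank-shift-S {S} stS apart = begin
          r (S ∪ (P ∪ ⁅ u ⁆))        ≡⟨ cong r (∪-assoc S P ⁅ u ⁆) ⟨
          r ((S ∪ P) ∪ ⁅ u ⁆)        ≡⟨ rank-shift (Subtr-∪P stS (Apart-P apart)) (¬Meets-∪P cls-u apart)
                                                   (q⊆p∪q S P) cls-u u≢v ⟩
          suc (r ((S ∪ P) ∪ ⁅ v ⁆))  ≡⟨ cong (λ X → suc (r X)) (∪-assoc S P ⁅ v ⁆) ⟩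
          suc (r (S ∪ (P ∪ ⁅ v ⁆)))  ∎
          where open ≡-Reasoning

        basis-shift→ : ∀ {S} → ContractionBasis (P ∪ ⁅ u ⁆) S → ContractionBasis (P ∪ ⁅ v ⁆) S
        basis-shift→ {S} (apart , stS , covers , rank) =
          Apart-swap cls-u cls-v apart , stS , Covers-swap cls-u cls-v covers ,
          ℕ.suc-injective (trans (sym (rank-shift-S stS apart)) (trans rank (cong (ℕ._+ ∣ S ∣) rank-shift-P)))

        basis-shift← : ∀ {S} → ContractionBasis (P ∪ ⁅ v ⁆) S → ContractionBasis (P ∪ ⁅ u ⁆) S
        basis-shift← {S} (apart , stS , covers , rank) = apart′ , stS , Covers-swap cls-v cls-u covers ,
          trans (rank-shift-S stS apart′) (trans (cong suc rank) (cong (ℕ._+ ∣ S ∣) (sym rank-shift-P)))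
          where
          apart′ = Apart-swap cls-v cls-u apart

        -- a class ω missed by P ∪ {u} lies below ω₀, so above ω the sets S ∪ P ∪ {u} and S ∪ P ∪ {v}
        -- differ only in u versus v, which have the same loops in ω
        module Unmet {S} (basis : ContractionBasis (P ∪ ⁅ u ⁆) S) {ω} (¬meets : ¬ Meets (P ∪ ⁅ u ⁆) ω) where
          apart : Apart (P ∪ ⁅ u ⁆) S
          apart = proj₁ basis

          stS : Subtr S
          stS = proj₁ (proj₂ basis)

          w : Fin n
          w = proj₁ (proj₁ (proj₂ (proj₂ basis)) ω ¬meets)

          w∈S : w ∈ S
          w∈S = proj₁ (proj₂ (proj₁ (proj₂ (proj₂ basis)) ω ¬meets))

          cls-w : cls w ≡ ω
          cls-w = proj₂ (proj₂ (proj₁ (proj₂ (proj₂ basis)) ω ¬meets))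

          ω≢ω₀ : ω ≢ ω₀
          ω≢ω₀ ω≡ω₀ = ¬meets (subst (Meets (P ∪ ⁅ u ⁆)) (trans cls-u (sym ω≡ω₀)) (Meets-∪⁅⁆ P u))

          ¬meets-P : ¬ Meets P ω
          ¬meets-P meets = ¬meets (Meets-mono (p⊆p∪q ⁅ u ⁆) meets)

          X : Subset n
          X = Above (S ∪ P) ω

          Above-∪ : ∀ {b} → cls b ≡ ω₀ → Above (S ∪ (P ∪ ⁅ b ⁆)) ω ≡ X ∪ ⁅ b ⁆
          Above-∪ {b} cls-b = trans (cong (λ W → Above W ω) (sym (∪-assoc S P ⁅ b ⁆)))
                                    (Above-∪⁅⁆ (subst (ω ≺_) (sym cls-b) (unmet-below ¬meets-P ω≢ω₀)))

          xOfIn-w : ∀ {b} → cls b ≡ ω₀ → xOfIn Z x t (S ∪ (P ∪ ⁅ b ⁆)) ω ≡ x w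
          xOfIn-w {b} cls-b = xOfIn-≡ w (Subtr-∪ stS (Subtr-P∪ cls-b) λ {a} {c} a∈S c∈ cls-ac →
                                           Apart-swap cls-u cls-b apart a a∈S (c , c∈ , sym cls-ac))
                                        (p⊆p∪q (P ∪ ⁅ b ⁆) w∈S) cls-w

          stX : Subtr X
          stX = Subtr-⊆ (Subtr-∪P stS (Apart-P apart)) Above-⊆

          P⊆X : P ⊆ X
          P⊆X w′∈P = ∈-Above⁺ (q⊆p∪q S P w′∈P) (met-above w′∈P ¬meets-P)

          ¬Meets-X : ¬ Meets X ω₀
          ¬Meets-X (w′ , w′∈ , cls-w′) = ¬Meets-∪P cls-u apart (w′ , Above-⊆ w′∈ , cls-w′)

          Subtr-X∪ : ∀ {b} → cls b ≡ ω₀ → Subtr (X ∪ ⁅ b ⁆)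
          Subtr-X∪ {b} cls-b = Subtr-∪⁅⁆ b stX (subst (λ ω′ → ¬ Meets X ω′) (sym cls-b) ¬Meets-X)

          ¬Meets-X∪ : ∀ {b} → cls b ≡ ω₀ → ¬ Meets (X ∪ ⁅ b ⁆) ω
          ¬Meets-X∪ cls-b meets =
            [ ¬Meets-Above , (λ cls-b≡ω → ω≢ω₀ (trans (sym cls-b≡ω) cls-b)) ]′ (Meets-∪⁅⁆⁻ meets)

          loops-agree : ∀ {y} → cls y ≡ ω →
                        (Loop (X ∪ ⁅ u ⁆) y → Loop (X ∪ ⁅ v ⁆) y) × (Loop (X ∪ ⁅ v ⁆) y → Loop (X ∪ ⁅ u ⁆) y)
          loops-agree {y} cls-y = Loop-shift⇔ (rank-shift stX ¬Meets-X P⊆X cls-u u≢v)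
            (rank-shift (Subtr-∪⁅⁆ y stX (subst (λ ω′ → ¬ Meets X ω′) (sym cls-y) ¬Meets-Above))
                        (λ meets → [ ¬Meets-X , (λ cls-y≡ω₀ → ω≢ω₀ (trans (sym cls-y) cls-y≡ω₀)) ]′ (Meets-∪⁅⁆⁻ meets))
                        (λ w′∈P → p⊆p∪q ⁅ y ⁆ (P⊆X w′∈P)) cls-u u≢v)

          activityFactor-shift : activityFactor (S ∪ (P ∪ ⁅ u ⁆)) ω ≡ activityFactor (S ∪ (P ∪ ⁅ v ⁆)) ω
          activityFactor-shift = begin
            loopFactor (Above (S ∪ (P ∪ ⁅ u ⁆)) ω) ω (xOfIn Z x t (S ∪ (P ∪ ⁅ u ⁆)) ω)
              ≡⟨ cong₂ (λ A y → loopFactor A ω y) (Above-∪ cls-u) (xOfIn-w cls-u) ⟩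
            loopFactor (X ∪ ⁅ u ⁆) ω (x w)
              ≡⟨ loopFactor-cong (x w) (Subtr-X∪ cls-v) (¬Meets-X∪ cls-v)
                   (λ y cls-y → proj₁ (loops-agree cls-y)) (λ y cls-y → proj₂ (loops-agree cls-y)) ⟩
            loopFactor (X ∪ ⁅ v ⁆) ω (x w)
              ≡⟨ cong₂ (λ A y → loopFactor A ω y) (Above-∪ cls-v) (xOfIn-w cls-v) ⟨
            loopFactor (Above (S ∪ (P ∪ ⁅ v ⁆)) ω) ω (xOfIn Z x t (S ∪ (P ∪ ⁅ v ⁆)) ω)
              ∎
            where open ≡-Reasoning

        relFactor-shift : ∀ {S} → ContractionBasis (P ∪ ⁅ u ⁆) S →
                          ∀ ω → relFactor (P ∪ ⁅ u ⁆) S ω ≡ relFactor (P ∪ ⁅ v ⁆) S ω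
        relFactor-shift basis ω with meets? (P ∪ ⁅ u ⁆) ω
        ... | yes meets = sym (if-yes (meets? (P ∪ ⁅ v ⁆) ω) (Meets-P∪-swap cls-u cls-v meets))
        ... | no ¬meets = trans (Unmet.activityFactor-shift basis ¬meets)
                                (sym (if-no (meets? (P ∪ ⁅ v ⁆) ω) (λ meets → ¬meets (Meets-P∪-swap cls-v cls-u meets))))

      contractionSum-shift : ∀ {u} → cls u ≡ ω₀ → contractionSum (P ∪ ⁅ u ⁆) ≡ contractionSum (P ∪ ⁅ v ⁆)
      contractionSum-shift {u} cls-u with u ≟ᶠ v
      ... | yes refl = refl
      ... | no u≢v = sumSub-cong λ S →
              when-⇔ (contractionBasis? (P ∪ ⁅ u ⁆) S) (contractionBasis? (P ∪ ⁅ v ⁆) S) basis-shift→ basis-shift←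
                     (λ basis → prodFin-cong (relFactor-shift basis))
        where open Shift cls-u u≢v

      other? : ∀ u → Dec (cls u ≡ ω₀ × ¬ u ≡ v)
      other? u = inClass? u ×-dec ¬? (u ≟ᶠ v)

      sumFin-split-v : ∀ (g : Fin n → ℚ) →
                       sumFin (λ u → when (inClass? u) (g u)) ≡ g v + sumFin (λ u → when (other? u) (g u))
      sumFin-split-v g = begin
        sumFin (λ u → when (inClass? u) (g u))
          ≡⟨ sumFin-cong (λ u → when-split (inClass? u) (u ≟ᶠ v) λ { refl → cls-v }) ⟩
        sumFin (λ u → when (u ≟ᶠ v) (g u) + when (other? u) (g u))
          ≡⟨ sumFin-+ (λ u → when (u ≟ᶠ v) (g u)) (λ u → when (other? u) (g u)) ⟩
        sumFin (λ u → when (u ≟ᶠ v) (g u)) + sumFin (λ u → when (other? u) (g u))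
          ≡⟨ cong (_+ sumFin (λ u → when (other? u) (g u)))
                  (trans (sumFin-single v (λ u u≢v → when-no (u ≟ᶠ v) u≢v)) (when-yes (v ≟ᶠ v) refl)) ⟩
        g v + sumFin (λ u → when (other? u) (g u))
          ∎
        where open ≡-Reasoning

      H : ℚ
      H = contractionSum (P ∪ ⁅ v ⁆)

      X₁ : ℚ
      X₁ = sumFin (λ u → when (other? u) (x u * H))

      ¬Loop-other : ∀ {u} → cls u ≡ ω₀ → u ≢ v → ¬ Loop P u
      ¬Loop-other cls-u u≢v loop-u = u≢v (loop-unique stP (¬Meets-cls cls-u) (trans cls-u (sym cls-v)) loop-u loop-v)

      vShare : ℚ
      vShare = (t * x v) * share ω₀

      vShares-sum : sumFin (λ u → when (other? u) (vShare * H)) ≡ (t * x v) * H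
      vShares-sum = begin
        sumFin (λ u → when (other? u) (vShare * H))
          ≡⟨ sumFin-cong (λ u → cong (when (other? u)) (ℚ.*-identityʳ (vShare * H))) ⟨
        sumFin (λ u → when (other? u) (vShare * H * 1ℚ))
          ≡⟨ sumFin-when-*ˡ other? (vShare * H) (λ _ → 1ℚ) ⟩
        vShare * H * sumFin (λ u → when (other? u) 1ℚ)
          ≡⟨ solve 4 (λ a s h k → ((a :* s) :* h) :* k := (a :* h) :* (s :* k)) refl (t * x v) (share ω₀) H _ ⟩
        (t * x v) * H * (share ω₀ * sumFin (λ u → when (other? u) 1ℚ))
          ≡⟨ cong ((t * x v) * H *_) (share-others nonDeg cls-v) ⟩
        (t * x v) * H * 1ℚ
          ≡⟨ ℚ.*-identityʳ _ ⟩
        (t * x v) * H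
          ∎
        where open ≡-Reasoning

      other-term : ∀ {u} → cls u ≡ ω₀ → u ≢ v →
                   when (¬? (loop? P u)) (ownFactor u * contractionSum (P ∪ ⁅ u ⁆)) ≡ vShare * H + x u * H
      other-term {u} cls-u u≢v = trans (when-yes (¬? (loop? P u)) (¬Loop-other cls-u u≢v))
        (trans (cong₂ _*_ (loopFactor-loop (x u) stP ¬meets₀ cls-v loop-v) (contractionSum-shift cls-u))
               (ℚ.*-distribʳ-+ H vShare (x u)))

      contractionSum-loop : contractionSum P ≡ (t * x v) * H + X₁
      contractionSum-loop = begin
        contractionSum P
          ≡⟨ trans contractionSum-split (sumFin-split-v _) ⟩
        when (¬? (loop? P v)) (ownFactor v * contractionSum (P ∪ ⁅ v ⁆)) +
        sumFin (λ u → when (other? u) (when (¬? (loop? P u)) (ownFactor u * contractionSum (P ∪ ⁅ u ⁆))))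
          ≡⟨ cong₂ _+_ (when-no (¬? (loop? P v)) (λ ¬loop → ¬loop loop-v))
                       (sumFin-cong (λ u → when-cong (other? u) λ (cls-u , u≢v) → other-term cls-u u≢v)) ⟩
        0ℚ + sumFin (λ u → when (other? u) (vShare * H + x u * H))
          ≡⟨ trans (ℚ.+-identityˡ _) (trans (sumFin-cong (λ u → when-+ (other? u) (vShare * H) (x u * H)))
                                            (sumFin-+ (λ u → when (other? u) (vShare * H)) _)) ⟩
        sumFin (λ u → when (other? u) (vShare * H)) + X₁
          ≡⟨ cong (_+ X₁) vShares-sum ⟩
        (t * x v) * H + X₁
          ∎
        where open ≡-Reasoning

      expansion-loop : (∀ u → cls u ≡ ω₀ → ExpansionAt (P ∪ ⁅ u ⁆)) → ExpansionAt P
      expansion-loop expansion-P∪ = begin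
        extensionSum P
          ≡⟨ trans extensionSum-split (sumFin-split-v _) ⟩
        extensionSum (P ∪ ⁅ v ⁆) + sumFin (λ u → when (other? u) (extensionSum (P ∪ ⁅ u ⁆)))
          ≡⟨ cong₂ _+_ (trans (expansion-P∪ v cls-v) (cong (_* H) (weight-loop cls-v loop-v)))
                       (trans (sumFin-cong (λ u → when-cong (other? u) λ (cls-u , u≢v) → other-extension cls-u u≢v))
                              (sumFin-when-*ˡ other? (weight P) (λ u → x u * H))) ⟩
        t * (weight P * x v) * H + weight P * X₁
          ≡⟨ solve 5 (λ t w xv h x₁ → t :* (w :* xv) :* h :+ w :* x₁ := w :* ((t :* xv) :* h :+ x₁))
                   refl t (weight P) (x v) H X₁ ⟩
        weight P * ((t * x v) * H + X₁)
          ≡⟨ cong (weight P *_) contractionSum-loop ⟨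
        weight P * contractionSum P
          ∎
        where
        open ≡-Reasoning
        other-extension : ∀ {u} → cls u ≡ ω₀ → u ≢ v → extensionSum (P ∪ ⁅ u ⁆) ≡ weight P * (x u * H)
        other-extension {u} cls-u u≢v = trans (expansion-P∪ u cls-u)
          (trans (cong₂ _*_ (weight-nonloop cls-u (¬Loop-other cls-u u≢v)) (contractionSum-shift cls-u))
                 (ℚ.*-assoc (weight P) (x u) H))

    expansion-step : (∀ u → cls u ≡ ω₀ → ExpansionAt (P ∪ ⁅ u ⁆)) → ExpansionAt P
    expansion-step with classLoop? P ω₀
    ... | yes (v , cls-v , loop-v) = WithLoop.expansion-loop cls-v loop-v
    ... | no ¬loop = expansion-noLoop (λ u cls-u loop-u → ¬loop (u , cls-u , loop-u))

  maxUnmet : ∀ {P ω} → ¬ Meets P ω → ∃ λ ω₀ → ¬ Meets P ω₀ × (∀ {ω′} → ¬ Meets P ω′ → ω′ ≺ ω₀ ⊎ ω′ ≡ ω₀)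
  maxUnmet {P} {ω} ¬meets = ω₀ , ¬meets₀ , λ ¬meets′ → lookup (xs≤max ω unmet) (∈-filter⁺ unmet? (∈-allFin _) ¬meets′)
    where
    ≼-totalOrder : TotalOrder 0ℓ 0ℓ 0ℓ
    ≼-totalOrder = record { isTotalOrder = StrictToNonStrict.isTotalOrder _≡_ _≺_ sto }
    open Extrema ≼-totalOrder using (max; xs≤max; argmax-all)
    unmet? : ∀ ω → Dec (¬ Meets P ω)
    unmet? ω = ¬? (meets? P ω)
    unmet : List (Fin m)
    unmet = filter unmet? (allFin m)
    ω₀ : Fin m
    ω₀ = max ω unmet
    ¬meets₀ : ¬ Meets P ω₀
    ¬meets₀ = argmax-all (λ ω′ → ω′) ¬meets (all-filter unmet? (allFin m))

  expansion : ∀ {P} → Acc _⊃_ P → Subtr P → UpperClosed P → ExpansionAt P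
  expansion {P} (acc larger) stP upP with any? (λ ω → ¬? (meets? P ω))
  ... | no ¬unmet = expansion-transversal (stP , λ ω → decidable-stable (meets? P ω) λ ¬meets → ¬unmet (ω , ¬meets))
  ... | yes (_ , ¬meets) with maxUnmet ¬meets
  ...   | ω₀ , ¬meets₀ , maximal = expansion-step λ u cls-u →
            expansion (larger (P⊂P∪u cls-u)) (Subtr-P∪ cls-u) (UpperClosed-P∪ cls-u)
    where
    open Step stP upP ¬meets₀ maximal
    P⊂P∪u : ∀ {u} → cls u ≡ ω₀ → P ⊂ P ∪ ⁅ u ⁆
    P⊂P∪u {u} cls-u = p⊆p∪q ⁅ u ⁆ , u , q⊆p∪q P ⁅ u ⁆ (x∈⁅x⁆ u) , ∉P cls-u

  Q≡extensionSum-⊥ : Q Z x t ≡ extensionSum ⊥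
  Q≡extensionSum-⊥ = trans (sumSubWhere-when (transversal? cls) weight) (sumSub-cong λ T →
    when-⇔ (transversal? cls T) (transversal? cls T ×-dec (⊥ ⊆? T))
           (λ trT → trT , λ u∈⊥ → ⊥-elim (∉⊥ u∈⊥)) proj₁ (λ _ → refl))

  weight-⊥ : weight ⊥ ≡ 1ℚ
  weight-⊥ = trans (cong₂ (λ k y → (t ^ℚ k) * y) (cong₂ _∸_ (∣⊥∣≡0 n) r-⊥) (prodIn-⊥ x)) (ℚ.*-identityˡ 1ℚ)

  contractionSum-⊥ : contractionSum ⊥ ≡ RHS Z x t _≺_ sto
  contractionSum-⊥ =
    trans (sumSub-cong term) (sym (sumSubWhere-when (basis? Z) (λ B → prodFin (factor Z x t _≺_ sto B))))
    where
    ¬Meets-⊥ : ∀ {ω} → ¬ Meets ⊥ ω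
    ¬Meets-⊥ (_ , u∈⊥ , _) = ∉⊥ u∈⊥
    rank-∪⊥ : ∀ {B} → r (B ∪ ⊥) ≡ r ⊥ ℕ.+ ∣ B ∣ → r B ≡ ∣ B ∣
    rank-∪⊥ {B} rank = trans (cong r (sym (∪-identityʳ B))) (trans rank (cong (ℕ._+ ∣ B ∣) r-⊥))
    basis⇒ : ∀ {B} → ContractionBasis ⊥ B → Basis Z B
    basis⇒ (_ , stB , covers , rank) = transversal⇒basis (stB , λ ω → covers ω ¬Meets-⊥) (stB , rank-∪⊥ rank)
    ⇒basis : ∀ {B} → Basis Z B → ContractionBasis ⊥ B
    ⇒basis {B} basis@((stB , rB) , _) =
      (λ _ _ → ¬Meets-⊥) , stB , (λ ω _ → proj₂ (basis⇒transversal nonDeg basis) ω) ,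
      trans (cong r (∪-identityʳ B)) (trans rB (cong (ℕ._+ ∣ B ∣) (sym r-⊥)))
    term : ∀ B → basisTerm ⊥ B ≡ when (basis? Z B) (prodFin (factor Z x t _≺_ sto B))
    term B = when-⇔ (contractionBasis? ⊥ B) (basis? Z B) basis⇒ ⇒basis λ cb → prodFin-cong λ ω →
      trans (if-no (meets? ⊥ ω) ¬Meets-⊥)
        (trans (cong (λ W → activityFactor W ω) (∪-identityʳ B))
               (sym (OnBasis.factor≡activityFactor (basis⇒transversal nonDeg (basis⇒ cb)) (proj₁ (basis⇒ cb)) ω)))

theorem3p5 : ∀ {n m : ℕ} (Z : Multimatroid n m) → NonDegenerate Z →
    (_≺_ : Rel (Fin m) 0ℓ) (sto : IsStrictTotalOrder _≡_ _≺_) →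
    (x : Fin n → ℚ) (t : ℚ) →
    Q Z x t ≡ RHS Z x t _≺_ sto
theorem3p5 Z nonDeg _≺_ sto x t = begin
  Q Z x t                        ≡⟨ Q≡extensionSum-⊥ ⟩
  extensionSum ⊥                 ≡⟨ expansion (⊃-wellFounded ⊥) Subtr-⊥ (λ u∈⊥ → ⊥-elim (∉⊥ u∈⊥)) ⟩
  weight ⊥ * contractionSum ⊥    ≡⟨ cong (_* contractionSum ⊥) weight-⊥ ⟩
  1ℚ * contractionSum ⊥          ≡⟨ ℚ.*-identityˡ (contractionSum ⊥) ⟩
  contractionSum ⊥               ≡⟨ contractionSum-⊥ ⟩
  RHS Z x t _≺_ sto              ∎
  where
  open MultimatroidProperties Z
  open Expansion Z nonDeg _≺_ sto x t
  open ≡-Reasoning
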